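{- For any $1\leq r<m<n$, one has $\Omega_r(M_{m,n})\subset M_{m,n+1}$.
   Context: $[n]_q=\frac{1-q^n}{1-q}$. Young diagrams in French convention (box $(i,j)$ in column $i$, row $j$, $(1,1)$ at bottom left). $\mathrm{SYT}_n$ is the set of standard Young tableaux of size $n$; $V_n$ is the $\mathbb{Q}(q)$-vector space with basis $\mathrm{SYT}_n$. For $T\in\mathrm{SYT}_n$ and $0\leq r\leq n$, the color sequence $\boldsymbol\delta^{(r)}(T)=(\delta_1,\ldots,\delta_{n+1})$ has $\delta_i=1$ iff column $i$ of $T$ is nonempty and its top box has label $>r$. Write $\boldsymbol\delta^{(r)}(T)=(1^{b_0},0^{a_1},1^{b_1},\ldots,0^{a_l},1^{b_l},0^{a_{l+1}})$ with $b_0\geq0$, $a_i,b_i>0$ ($1\leq i\leq l$), $l=l^{(r)}(T)$. For $0\leq k\leq l$: $c_k^{(r)}(T)=\sum_{i=1}^k a_i+\sum_{i=0}^k b_i+1$; $f_k^{(r)}(T)$ is $T$ with a box labeled $n+1$ added on top of column $c_k^{(r)}(T)$; and $\varphi_k^{(r)}(T;q)=q^{\sum_{i=1}^k a_i}\prod_{i=1}^{k}\frac{[\sum_{j=i+1}^{k}a_j+\sum_{j=i}^{k}b_j]_q}{[\sum_{j=i}^{k}a_j+\sum_{j=i}^{k}b_j]_q}\prod_{i=k+1}^{l}\frac{[\sum_{j=k+1}^{i}a_j+\sum_{j=k+1}^{i-1}b_j]_q}{[\sum_{j=k+1}^{i}a_j+\sum_{j=k+1}^{i}b_j]_q}$.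 $\Omega_r:V_n\to V_{n+1}$ is the $\mathbb{Q}(q)$-linear map with $\Omega_r(T)=\sum_{k=0}^{l^{(r)}(T)}\varphi_k^{(r)}(T;q)f_k^{(r)}(T)$. For $1\leq m<N$ and $T\in\mathrm{SYT}_N$, $\tau_m(T)$ is the tableau obtained by exchanging the labels $m$ and $m+1$, when this is standard. $M_{m,N}\subset V_N$ is the $\mathbb{Q}(q)$-span of the elements $R_m(T)=T+q\frac{[L-1]_q}{[L+1]_q}\tau_m(T)$, over all $T\in\mathrm{SYT}_N$ such that the box labeled $m$ is the top box of some column $c$ and the box labeled $m+1$ is the top box of column $c+L$ with $L\geq1$ (when $L=1$, $R_m(T)=T$). -}

module Defs where

open import Data.Nat as ℕ using (ℕ; zero; suc; _∸_; _≤_)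
open import Data.Integer as ℤ using (ℤ; 0ℤ; 1ℤ)
open import Data.Bool using (Bool; true; false)
open import Data.Maybe using (Maybe; just; nothing)
open import Data.List using (List; []; _∷_; _++_; map; concat; concatMap; applyUpTo; length; last; replicate)
open import Data.List.Properties using (≡-dec)
open import Data.List.Relation.Unary.All using (All)
open import Data.List.Relation.Unary.Linked using (Linked)
open import Data.List.Relation.Binary.Permutation.Propositional using (_↭_)
open import Data.Product using (_×_; _,_; proj₁; proj₂; ∃; Σ)
open import Data.Unit using (⊤)
open import Data.Empty using (⊥)
open import Relation.Nullary using (¬_; yes; no)
open import Relation.Binary.PropositionalEquality using (_≡_)

-- The field ℚ(q), realised as the fraction field of ℤ[q].
-- Polynomials: coefficient lists, lowest degree first.

Poly : Set
Poly = List ℤ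

coeff : Poly → ℕ → ℤ
coeff []      _       = 0ℤ
coeff (a ∷ p) zero    = a
coeff (a ∷ p) (suc i) = coeff p i

-- equality of polynomials (trailing zeros irrelevant)
_≈P_ : Poly → Poly → Set
p ≈P p' = ∀ i → coeff p i ≡ coeff p' i

_+P_ : Poly → Poly → Poly
[]      +P p'       = p'
(a ∷ p) +P []       = a ∷ p
(a ∷ p) +P (b ∷ p') = (a ℤ.+ b) ∷ (p +P p')

_*P_ : Poly → Poly → Poly
[]      *P p' = []
(a ∷ p) *P p' = map (a ℤ.*_) p' +P (0ℤ ∷ (p *P p'))

-- elements of ℚ(q): num / den  (meaningful when den is nonzero)
record Frac : Set where
  constructor frac
  field
    num : Poly
    den : Poly
open Frac public

NonZeroDen : Frac → Set
NonZeroDen x = ¬ (den x ≈P [])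

_≈F_ : Frac → Frac → Set
x ≈F y = (num x *P den y) ≈P (num y *P den x)

0F 1F : Frac
0F = frac [] (1ℤ ∷ [])
1F = frac (1ℤ ∷ []) (1ℤ ∷ [])

_+F_ : Frac → Frac → Frac
x +F y = frac ((num x *P den y) +P (num y *P den x)) (den x *P den y)

_*F_ : Frac → Frac → Frac
x *F y = frac (num x *P num y) (den x *P den y)

polyF : Poly → Frac
polyF p = frac p (1ℤ ∷ [])

_÷P_ : Poly → Poly → Frac
p ÷P p' = frac p p'

qint : ℕ → Poly
qint n = replicate n 1ℤ

qpow : ℕ → Poly
qpow k = replicate k 0ℤ ++ (1ℤ ∷ [])

qvar : Poly
qvar = 0ℤ ∷ 1ℤ ∷ []

-- Young tableaux in French convention, stored as the list of columns
-- (column 1 first); each column lists its labels from bottom to top.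

Tab : Set
Tab = List (List ℕ)

RowLt : List ℕ → List ℕ → Set
RowLt _        []       = ⊤
RowLt []       (y ∷ ys) = ⊥
RowLt (x ∷ xs) (y ∷ ys) = (x ℕ.< y) × RowLt xs ys

IsSYT : ℕ → Tab → Set
IsSYT n T =
  All (λ col → ¬ (col ≡ [])) T ×
  All (Linked ℕ._<_) T ×
  Linked RowLt T ×                         -- partition shape, rows increase
  (concat T ↭ applyUpTo suc n)

-- column i (1-indexed); empty if beyond the diagram
column : Tab → ℕ → List ℕ
column _        zero          = []
column []       (suc _)       = []
column (c ∷ cs) (suc zero)    = c
column (c ∷ cs) (suc (suc i)) = column cs (suc i)

top : Tab → ℕ → Maybe ℕ
top T i = last (column T i)

addTop : ℕ → ℕ → Tab → Tab
addTop zero          x T        = T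
addTop (suc zero)    x []       = (x ∷ []) ∷ []
addTop (suc zero)    x (c ∷ cs) = (c ++ (x ∷ [])) ∷ cs
addTop (suc (suc i)) x []       = [] ∷ addTop (suc i) x []
addTop (suc (suc i)) x (c ∷ cs) = c ∷ addTop (suc i) x cs

swapLabel : ℕ → ℕ → ℕ
swapLabel m x with x ℕ.≟ m | x ℕ.≟ suc m
... | yes _ | _     = suc m
... | no _  | yes _ = m
... | no _  | no _  = x

τ : ℕ → Tab → Tab
τ m T = map (map (swapLabel m)) T

V : Set
V = List (Frac × Tab)

coefV : V → Tab → Frac
coefV []             T = 0F
coefV ((c , S) ∷ vs) T with ≡-dec (≡-dec ℕ._≟_) S T
... | yes _ = c +F coefV vs T
... | no _  = coefV vs T

_≈V_ : V → V → Set
v ≈V w = ∀ T → coefV v T ≈F coefV w T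

WF : V → Set
WF v = All (λ e → NonZeroDen (proj₁ e)) v

scale : Frac → V → V
scale c v = map (λ e → (c *F proj₁ e , proj₂ e)) v

-- Σ_{j=lo}^{hi} f j   (empty when hi < lo)
range : ℕ → ℕ → List ℕ
range lo hi = applyUpTo (lo ℕ.+_) (suc hi ∸ lo)

sumR : (ℕ → ℕ) → ℕ → ℕ → ℕ
sumR f lo hi = sumℕ (map f (range lo hi))
  where open import Data.Nat.ListAction renaming (sum to sumℕ)

prodF : List Frac → Frac
prodF []       = 1F
prodF (x ∷ xs) = x *F prodF xs

prodR : (ℕ → Frac) → ℕ → ℕ → Frac
prodR f lo hi = prodF (map f (range lo hi))

isColored : ℕ → Maybe ℕ → Bool
isColored r nothing  = false
isColored r (just x) with r ℕ.<? x
... | yes _ = true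
... | no _  = false

δseq : ℕ → ℕ → Tab → List Bool
δseq r n T = applyUpTo (λ i → isColored r (top T (suc i))) (suc n)

rle : List Bool → List (Bool × ℕ)
rle []       = []
rle (x ∷ xs) = step (rle xs)
  where
  eqB : Bool → Bool → Bool
  eqB true true   = true
  eqB false false = true
  eqB _ _         = false
  step : List (Bool × ℕ) → List (Bool × ℕ)
  step []               = (x , 1) ∷ []
  step ((y , k) ∷ rs) with eqB x y
  ... | true  = (y , suc k) ∷ rs
  ... | false = (x , 1) ∷ (y , k) ∷ rs

pairsAB : List (Bool × ℕ) → List (ℕ × ℕ)
pairsAB ((false , a) ∷ (true , b) ∷ rs) = (a , b) ∷ pairsAB rs
pairsAB _                               = []

-- (b_0 , [(a_1,b_1),…,(a_l,b_l)]) for δ = (1^{b_0},0^{a_1},1^{b_1},…,0^{a_l},1^{b_l},0^{a_{l+1}})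
decomp : List Bool → ℕ × List (ℕ × ℕ)
decomp δs with rle δs
... | (true , b) ∷ rs = b , pairsAB rs
... | rs              = 0 , pairsAB rs

nth : List (ℕ × ℕ) → ℕ → ℕ × ℕ
nth []       _       = 0 , 0
nth (x ∷ xs) zero    = x
nth (x ∷ xs) (suc i) = nth xs i

ΩT : ℕ → ℕ → Tab → V
ΩT r n T = map term (applyUpTo (λ k → k) (suc l))
  where
  d  = decomp (δseq r n T)
  b0 = proj₁ d
  ab = proj₂ d
  l  = length ab
  -- a_i, b_i (1-indexed; b_0 as above)
  a : ℕ → ℕ
  a zero    = 0
  a (suc i) = proj₁ (nth ab i)
  b : ℕ → ℕ
  b zero    = b0
  b (suc i) = proj₂ (nth ab i)
  c : ℕ → ℕ
  c k = sumR a 1 k ℕ.+ sumR b 0 k ℕ.+ 1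
  φ : ℕ → Frac
  φ k = polyF (qpow (sumR a 1 k))
        *F (prodR (λ i → qint (sumR a (suc i) k ℕ.+ sumR b i k)
                          ÷P qint (sumR a i k ℕ.+ sumR b i k)) 1 k
        *F prodR (λ i → qint (sumR a (suc k) i ℕ.+ sumR b (suc k) (i ∸ 1))
                          ÷P qint (sumR a (suc k) i ℕ.+ sumR b (suc k) i)) (suc k) l)
  term : ℕ → Frac × Tab
  term k = φ k , addTop (c k) (suc n) T

Ω : ℕ → ℕ → V → V
Ω r n v = concatMap (λ e → scale (proj₁ e) (ΩT r n (proj₂ e))) v

Gen : ℕ → ℕ → ℕ → ℕ → Tab → Set
Gen m N c L T =
  IsSYT N T × 1 ≤ c × 1 ≤ L × top T c ≡ just m × top T (c ℕ.+ L) ≡ just (suc m)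

-- R_m(T) = T + q [L-1]_q/[L+1]_q τ_m(T)  (= T when L = 1)
R : ℕ → ℕ → Tab → V
R m (suc zero) T = (1F , T) ∷ []
R m L          T = (1F , T) ∷ (((qvar *P qint (L ∸ 1)) ÷P qint (suc L) , τ m T) ∷ [])

-- generator data: (coefficient, column c, L, tableau T)
GenData : Set
GenData = Frac × ℕ × ℕ × Tab

lincomb : ℕ → List GenData → V
lincomb m gs = concatMap (λ g → scale (proj₁ g) (R m (proj₁ (proj₂ (proj₂ g))) (proj₂ (proj₂ (proj₂ g))))) gs

InM : ℕ → ℕ → V → Set
InM m N v = Σ (List GenData) λ gs →
  All (λ g → NonZeroDen (proj₁ g) ×
             Gen m N (proj₁ (proj₂ g)) (proj₁ (proj₂ (proj₂ g))) (proj₂ (proj₂ (proj₂ g)))) gs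
  × v ≈V lincomb m gs

-- Over ℚ(q), Ω_r is the linear extension of T ↦ Σ_k φ_k f_k(T), and R_m(T) = T + ρ_L τ_m(T) with
-- ρ_L = q[L-1]_q/[L+1]_q (so ρ_1 = 0). For r < m < n the labels m and m+1 are both coloured, so τ_m
-- changes neither the colour sequence nor the new label n+1: Ω_r commutes with τ_m, whence
-- Ω_r(R_m(T)) = Σ_k φ_k R_m(f_k(T)). Each f_k(T) is again a generator with the same c and L: the box
-- n+1 goes on top of an uncoloured column whose left neighbour is coloured (or which is the first
-- column), so the shape stays a partition, and it never lands on the coloured columns c and c+L.
-- Since Ω_r is well defined on coefficient vectors, linearity finishes the argument.

module Submission where

open import Defs
open import Level using (0ℓ; _⊔_)
open import Algebra.Bundles using (CommutativeRing; CommutativeSemiring)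
open import Algebra.Structures using (IsCommutativeRing)
open import Algebra.Structures.Biased using (isCommutativeSemiringˡ; isCommutativeMonoidˡ)
import Algebra.Consequences.Setoid as Consequences
import Algebra.Definitions as AlgebraDefinitions
import Tactic.RingSolver.Core.AlmostCommutativeRing as ACR
open import Tactic.RingSolver using (solve-∀)
open import Data.Integer as ℤ using (ℤ; 0ℤ; 1ℤ)
import Data.Integer.Properties as ℤₚ
open import Data.Nat as ℕ using (ℕ; zero; suc; _≤_; _<_; s≤s; z≤n; _∸_)
import Data.Nat.Properties as ℕₚ
open import Data.Nat.ListAction using (sum)
open import Data.List
  using (List; []; _∷_; _++_; map; concat; concatMap; deduplicate; applyUpTo; length; last; replicate; take; drop)
open import Data.List.Properties
  using ( ≡-dec; concatMap-++; concatMap-map; map-++; map-cong; map-∘; ++-assoc; ++-identityʳ; last-map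
        ; length-++; length-replicate; length-applyUpTo; map-applyUpTo; applyUpTo-∷ʳ; ∷ʳ-injectiveʳ)
open import Data.List.Relation.Unary.All using (All; []; _∷_)
import Data.List.Relation.Unary.All as All
import Data.List.Relation.Unary.All.Properties as Allₚ
open import Data.List.Relation.Unary.Any using (here; there)
open import Data.List.Relation.Unary.AllPairs using (_∷_)
open import Data.List.Relation.Unary.Linked using (Linked; []; [-]; _∷_)
open import Data.List.Relation.Unary.Unique.Propositional using (Unique)
open import Data.List.Relation.Binary.Permutation.Propositional using (_↭_; ↭-refl; ↭-sym; ↭-trans; ↭-reflexive)
import Data.List.Relation.Binary.Permutation.Propositional.Properties as ↭ₚ
open import Data.List.Membership.Propositional using (_∈_)
open import Data.List.Membership.Propositional.Properties using (∈-++⁺ˡ; ∈-++⁺ʳ; ∈-deduplicate⁺)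
open import Data.Maybe as Maybe using (just; nothing)
open import Data.Bool using (Bool; true; false; not)
open import Data.Unit using (⊤; tt)
open import Data.Product using (_×_; _,_; proj₁; proj₂; Σ)
open import Data.Sum using (_⊎_; inj₁; inj₂)
open import Data.Empty using (⊥-elim)
open import Function using (_∘_; id)
open import Relation.Nullary using (¬_; yes; no; contradiction)
open import Relation.Binary.Definitions using (DecidableEquality)
open import Relation.Binary.Structures using (IsEquivalence)
open import Relation.Binary.Bundles using (Setoid)
open import Relation.Binary.PropositionalEquality
  using (_≡_; _≢_; refl; sym; trans; cong; cong₂; subst; subst₂)

-- Formal linear combinations over a commutative semiring

module FormalCombination {c ℓ b} (𝕊 : CommutativeSemiring c ℓ) {B : Set b} (_≟_ : DecidableEquality B) where

  open CommutativeSemiring 𝕊 renaming (refl to ≈-refl; sym to ≈-sym; trans to ≈-trans)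
  open import Relation.Binary.Reasoning.Setoid setoid
  open import Algebra.Properties.CommutativeSemigroup +-commutativeSemigroup using (interchange)
  open import Data.List.Relation.Unary.Unique.DecPropositional.Properties _≟_ using (deduplicate-!)

  Combination : Set _
  Combination = List (Carrier × B)

  coef : Combination → B → Carrier
  coef []             T = 0#
  coef ((a , S) ∷ v) T with S ≟ T
  ... | yes _ = a + coef v T
  ... | no  _ = coef v T

  infix 4 _≈ᶜ_
  record _≈ᶜ_ (v w : Combination) : Set (b ⊔ ℓ) where
    constructor mk≈ᶜ
    field coef-≈ : ∀ T → coef v T ≈ coef w T
  open _≈ᶜ_ public

  ≈ᶜ-refl : ∀ {v} → v ≈ᶜ v
  ≈ᶜ-refl = mk≈ᶜ λ _ → ≈-refl

  ≈ᶜ-sym : ∀ {v w} → v ≈ᶜ w → w ≈ᶜ v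
  ≈ᶜ-sym (mk≈ᶜ v≈w) = mk≈ᶜ λ T → ≈-sym (v≈w T)

  ≈ᶜ-trans : ∀ {u v w} → u ≈ᶜ v → v ≈ᶜ w → u ≈ᶜ w
  ≈ᶜ-trans (mk≈ᶜ u≈v) (mk≈ᶜ v≈w) = mk≈ᶜ λ T → ≈-trans (u≈v T) (v≈w T)

  ≈ᶜ-setoid : Setoid (c ⊔ b) (b ⊔ ℓ)
  ≈ᶜ-setoid = record
    { Carrier       = Combination
    ; _≈_           = _≈ᶜ_
    ; isEquivalence = record { refl = ≈ᶜ-refl ; sym = ≈ᶜ-sym ; trans = ≈ᶜ-trans }
    }

  ≡⇒≈ᶜ : ∀ {v w} → v ≡ w → v ≈ᶜ w
  ≡⇒≈ᶜ refl = ≈ᶜ-refl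

  scaleᶜ : Carrier → Combination → Combination
  scaleᶜ a = map (λ e → a * proj₁ e , proj₂ e)

  rename : (B → B) → Combination → Combination
  rename h = map (λ e → proj₁ e , h (proj₂ e))

  bind : (B → Combination) → Combination → Combination
  bind f = concatMap (λ e → scaleᶜ (proj₁ e) (f (proj₂ e)))

  coef-single-≡ : ∀ a S → coef ((a , S) ∷ []) S ≈ a
  coef-single-≡ a S with S ≟ S
  ... | yes _   = +-identityʳ a
  ... | no S≢S = contradiction refl S≢S

  coef-single-≢ : ∀ a {S T} → S ≢ T → coef ((a , S) ∷ []) T ≈ 0#
  coef-single-≢ a {S} {T} S≢T with S ≟ T
  ... | yes S≡T = contradiction S≡T S≢T
  ... | no _    = ≈-refl

  coef-∷ : ∀ a S v T → coef ((a , S) ∷ v) T ≈ coef ((a , S) ∷ []) T + coef v T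
  coef-∷ a S v T with S ≟ T
  ... | yes _ = +-congʳ (≈-sym (+-identityʳ a))
  ... | no  _ = ≈-sym (+-identityˡ (coef v T))

  coef-++ : ∀ v w T → coef (v ++ w) T ≈ coef v T + coef w T
  coef-++ []             w T = ≈-sym (+-identityˡ (coef w T))
  coef-++ ((a , S) ∷ v) w T = begin
    coef ((a , S) ∷ v ++ w) T                               ≈⟨ coef-∷ a S (v ++ w) T ⟩
    coef ((a , S) ∷ []) T + coef (v ++ w) T                 ≈⟨ +-congˡ (coef-++ v w T) ⟩
    coef ((a , S) ∷ []) T + (coef v T + coef w T)           ≈⟨ +-assoc _ _ _ ⟨
    (coef ((a , S) ∷ []) T + coef v T) + coef w T           ≈⟨ +-congʳ (coef-∷ a S v T) ⟨
    coef ((a , S) ∷ v) T + coef w T                         ∎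

  coef-scale : ∀ a v T → coef (scaleᶜ a v) T ≈ a * coef v T
  coef-scale a []             T = ≈-sym (zeroʳ a)
  coef-scale a ((c , S) ∷ v) T with S ≟ T
  ... | yes _ = ≈-trans (+-congˡ (coef-scale a v T)) (≈-sym (distribˡ a c (coef v T)))
  ... | no  _ = coef-scale a v T

  ∷-cong : ∀ {a a′} S {v w} → a ≈ a′ → v ≈ᶜ w → (a , S) ∷ v ≈ᶜ (a′ , S) ∷ w
  ∷-cong S a≈a′ (mk≈ᶜ v≈w) = mk≈ᶜ coef-∷-≈
    where
    coef-∷-≈ : ∀ T → coef ((_ , S) ∷ _) T ≈ coef ((_ , S) ∷ _) T
    coef-∷-≈ T with S ≟ T
    ... | yes _ = +-cong a≈a′ (v≈w T)
    ... | no  _ = v≈w T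

  ∷-≈0 : ∀ {a} S v → a ≈ 0# → (a , S) ∷ v ≈ᶜ v
  ∷-≈0 S v a≈0 = mk≈ᶜ coef-∷-≈
    where
    coef-∷-≈ : ∀ T → coef ((_ , S) ∷ v) T ≈ coef v T
    coef-∷-≈ T with S ≟ T
    ... | yes _ = ≈-trans (+-congʳ a≈0) (+-identityˡ (coef v T))
    ... | no  _ = ≈-refl

  ++-cong : ∀ {v v′ w w′} → v ≈ᶜ v′ → w ≈ᶜ w′ → v ++ w ≈ᶜ v′ ++ w′
  ++-cong {v} {v′} {w} {w′} (mk≈ᶜ v≈v′) (mk≈ᶜ w≈w′) = mk≈ᶜ λ T →
    ≈-trans (coef-++ v w T) (≈-trans (+-cong (v≈v′ T) (w≈w′ T)) (≈-sym (coef-++ v′ w′ T)))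

  ++-comm : ∀ v w → v ++ w ≈ᶜ w ++ v
  ++-comm v w = mk≈ᶜ λ T →
    ≈-trans (coef-++ v w T) (≈-trans (+-comm (coef v T) (coef w T)) (≈-sym (coef-++ w v T)))

  scale-cong : ∀ a {v w} → v ≈ᶜ w → scaleᶜ a v ≈ᶜ scaleᶜ a w
  scale-cong a {v} {w} (mk≈ᶜ v≈w) = mk≈ᶜ λ T →
    ≈-trans (coef-scale a v T) (≈-trans (*-congˡ (v≈w T)) (≈-sym (coef-scale a w T)))

  scale-identity : ∀ v → scaleᶜ 1# v ≈ᶜ v
  scale-identity v = mk≈ᶜ λ T → ≈-trans (coef-scale 1# v T) (*-identityˡ (coef v T))

  scale-scale : ∀ a c v → scaleᶜ (a * c) v ≈ᶜ scaleᶜ a (scaleᶜ c v)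
  scale-scale a c v = mk≈ᶜ λ T → begin
    coef (scaleᶜ (a * c) v) T     ≈⟨ coef-scale (a * c) v T ⟩
    a * c * coef v T             ≈⟨ *-assoc a c (coef v T) ⟩
    a * (c * coef v T)           ≈⟨ *-congˡ (coef-scale c v T) ⟨
    a * coef (scaleᶜ c v) T       ≈⟨ coef-scale a (scaleᶜ c v) T ⟨
    coef (scaleᶜ a (scaleᶜ c v)) T ∎

  bind-congˡ : ∀ {f g} → (∀ S → f S ≈ᶜ g S) → ∀ v → bind f v ≈ᶜ bind g v
  bind-congˡ f≈g []             = ≈ᶜ-refl
  bind-congˡ f≈g ((a , S) ∷ v) = ++-cong (scale-cong a (f≈g S)) (bind-congˡ f≈g v)

  bind-scale : ∀ f a v → bind f (scaleᶜ a v) ≈ᶜ scaleᶜ a (bind f v)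
  bind-scale f a []             = ≈ᶜ-refl
  bind-scale f a ((c , S) ∷ v) =
    ≈ᶜ-trans (++-cong (scale-scale a c (f S)) (bind-scale f a v))
             (≡⇒≈ᶜ (sym (map-++ _ (scaleᶜ c (f S)) (bind f v))))

  ∷-++-comm : ∀ p v w → p ∷ (v ++ w) ≈ᶜ v ++ (p ∷ w)
  ∷-++-comm p v w = ≈ᶜ-trans (++-cong (++-comm (p ∷ []) v) ≈ᶜ-refl) (≡⇒≈ᶜ (++-assoc v (p ∷ []) w))

  pair : Carrier → (B → B) → B → Combination
  pair b h S = (1# , S) ∷ (b , h S) ∷ []

  bind-pair-left : ∀ f b h S → bind f (pair b h S) ≈ᶜ f S ++ scaleᶜ b (f (h S))
  bind-pair-left f b h S =
    ++-cong (scale-identity (f S)) (≡⇒≈ᶜ (++-identityʳ (scaleᶜ b (f (h S)))))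

  bind-pair-right : ∀ b h v → bind (pair b h) v ≈ᶜ v ++ scaleᶜ b (rename h v)
  bind-pair-right b h []             = ≈ᶜ-refl
  bind-pair-right b h ((c , S) ∷ v) =
    ∷-cong S (*-identityʳ c) (≈ᶜ-trans (∷-cong (h S) (*-comm c b) (bind-pair-right b h v))
                                        (∷-++-comm _ v (scaleᶜ b (rename h v))))

  bind-pair-comm : ∀ f b h → (∀ S → f (h S) ≈ᶜ rename h (f S)) →
                   ∀ S → bind f (pair b h S) ≈ᶜ bind (pair b h) (f S)
  bind-pair-comm f b h f∘h≈h∘f S =
    ≈ᶜ-trans (bind-pair-left f b h S)
    (≈ᶜ-trans (++-cong ≈ᶜ-refl (scale-cong b (f∘h≈h∘f S)))
              (≈ᶜ-sym (bind-pair-right b h (f S))))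

  weightedSum : Combination → (B → Carrier) → Carrier
  weightedSum []             g = 0#
  weightedSum ((a , S) ∷ v) g = a * g S + weightedSum v g

  coef-bind : ∀ f v T → coef (bind f v) T ≈ weightedSum v (λ S → coef (f S) T)
  coef-bind f []             T = ≈-refl
  coef-bind f ((a , S) ∷ v) T =
    ≈-trans (coef-++ (scaleᶜ a (f S)) (bind f v) T) (+-cong (coef-scale a (f S) T) (coef-bind f v T))

  sumOver : List B → (B → Carrier) → Carrier
  sumOver []      h = 0#
  sumOver (S ∷ U) h = h S + sumOver U h

  sumOver-cong : ∀ U {h h′ : B → Carrier} → (∀ S → h S ≈ h′ S) → sumOver U h ≈ sumOver U h′
  sumOver-cong []      h≈h′ = ≈-refl
  sumOver-cong (S ∷ U) h≈h′ = +-cong (h≈h′ S) (sumOver-cong U h≈h′)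

  sumOver-+ : ∀ U h h′ → sumOver U (λ S → h S + h′ S) ≈ sumOver U h + sumOver U h′
  sumOver-+ []      h h′ = ≈-sym (+-identityˡ 0#)
  sumOver-+ (S ∷ U) h h′ =
    ≈-trans (+-congˡ (sumOver-+ U h h′)) (interchange (h S) (h′ S) (sumOver U h) (sumOver U h′))

  sumOver-zero : ∀ {U} h → All (λ S → h S ≈ 0#) U → sumOver U h ≈ 0#
  sumOver-zero h []            = ≈-refl
  sumOver-zero h (hS≈0 ∷ h≈0) = ≈-trans (+-cong hS≈0 (sumOver-zero h h≈0)) (+-identityˡ 0#)

  sumOver-single : ∀ {U} a (g : B → Carrier) {S} → Unique U → S ∈ U →
                   sumOver U (λ T → coef ((a , S) ∷ []) T * g T) ≈ a * g S
  sumOver-single a g {S} (S∉U ∷ _) (here refl) =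
    ≈-trans (+-cong (*-congʳ (coef-single-≡ a S))
                    (sumOver-zero _ (All.map (λ S≢T → ≈-trans (*-congʳ (coef-single-≢ a S≢T)) (zeroˡ _)) S∉U)))
            (+-identityʳ (a * g S))
  sumOver-single a g {S} (T∉U ∷ U!) (there S∈U) =
    ≈-trans (+-cong (≈-trans (*-congʳ (coef-single-≢ a (λ S≡T → All.lookup T∉U S∈U (sym S≡T)))) (zeroˡ _))
                    (sumOver-single a g U! S∈U))
            (+-identityˡ (a * g S))

  weightedSum≈sumOver : ∀ {U} v (g : B → Carrier) → Unique U → All (_∈ U) (map proj₂ v) →
                        weightedSum v g ≈ sumOver U (λ T → coef v T * g T)
  weightedSum≈sumOver {U} [] g U! _ = ≈-sym (sumOver-zero {U} (λ T → 0# * g T) (All.tabulate λ {T} _ → zeroˡ (g T)))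
  weightedSum≈sumOver {U} ((a , S) ∷ v) g U! (S∈U ∷ v⊆U) = begin
    a * g S + weightedSum v g
      ≈⟨ +-cong (sumOver-single a g U! S∈U) (≈-sym (weightedSum≈sumOver v g U! v⊆U)) ⟨
    sumOver U (λ T → coef ((a , S) ∷ []) T * g T) + sumOver U (λ T → coef v T * g T)
      ≈⟨ sumOver-+ U _ _ ⟨
    sumOver U (λ T → coef ((a , S) ∷ []) T * g T + coef v T * g T)
      ≈⟨ sumOver-cong U (λ T → ≈-trans (*-congʳ (coef-∷ a S v T)) (distribʳ (g T) _ _)) ⟨
    sumOver U (λ T → coef ((a , S) ∷ v) T * g T)
      ∎

  weightedSum-cong : ∀ {v w} (g : B → Carrier) → v ≈ᶜ w → weightedSum v g ≈ weightedSum w g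
  weightedSum-cong {v} {w} g (mk≈ᶜ v≈w) = begin
    weightedSum v g                   ≈⟨ weightedSum≈sumOver v g U! (All.tabulate (support-⊆ ∘ ∈-++⁺ˡ)) ⟩
    sumOver U (λ T → coef v T * g T)  ≈⟨ sumOver-cong U (λ T → *-congʳ (v≈w T)) ⟩
    sumOver U (λ T → coef w T * g T)  ≈⟨ weightedSum≈sumOver w g U! (All.tabulate (support-⊆ ∘ ∈-++⁺ʳ _)) ⟨
    weightedSum w g                   ∎
    where
    supports = map proj₂ v ++ map proj₂ w
    U = deduplicate _≟_ supports
    U! : Unique U
    U! = deduplicate-! supports
    support-⊆ : ∀ {T} → T ∈ supports → T ∈ U
    support-⊆ = ∈-deduplicate⁺ _≟_

  bind-congʳ : ∀ f {v w} → v ≈ᶜ w → bind f v ≈ᶜ bind f w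
  bind-congʳ f {v} {w} v≈w = mk≈ᶜ λ T →
    ≈-trans (coef-bind f v T) (≈-trans (weightedSum-cong _ v≈w) (≈-sym (coef-bind f w T)))

-- The polynomial ring ℤ[q]

infix 4 _≋_
record _≋_ (p p′ : Poly) : Set where
  constructor mk≋
  field coeff-≡ : p ≈P p′
open _≋_

≋-isEquivalence : IsEquivalence _≋_
≋-isEquivalence = record
  { refl  = mk≋ λ _ → refl
  ; sym   = λ (mk≋ e) → mk≋ λ i → sym (e i)
  ; trans = λ (mk≋ e) (mk≋ f) → mk≋ λ i → trans (e i) (f i)
  }

Poly-setoid : Setoid 0ℓ 0ℓ
Poly-setoid = record { isEquivalence = ≋-isEquivalence }

open Setoid Poly-setoid using () renaming (refl to ≋-refl; sym to ≋-sym; trans to ≋-trans)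

_·P_ : ℤ → Poly → Poly
a ·P p = map (a ℤ.*_) p

-P_ : Poly → Poly
-P p = map ℤ.-_ p

1P : Poly
1P = 1ℤ ∷ []

coeff-+P : ∀ p p′ i → coeff (p +P p′) i ≡ coeff p i ℤ.+ coeff p′ i
coeff-+P []      p′       i       = sym (ℤₚ.+-identityˡ _)
coeff-+P (a ∷ p) []       zero    = sym (ℤₚ.+-identityʳ _)
coeff-+P (a ∷ p) []       (suc i) = sym (ℤₚ.+-identityʳ _)
coeff-+P (a ∷ p) (b ∷ p′) zero    = refl
coeff-+P (a ∷ p) (b ∷ p′) (suc i) = coeff-+P p p′ i

coeff-·P : ∀ a p i → coeff (a ·P p) i ≡ a ℤ.* coeff p i
coeff-·P a []      i       = sym (ℤₚ.*-zeroʳ a)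
coeff-·P a (b ∷ p) zero    = refl
coeff-·P a (b ∷ p) (suc i) = coeff-·P a p i

coeff--P : ∀ p i → coeff (-P p) i ≡ ℤ.- coeff p i
coeff--P []      i       = refl
coeff--P (a ∷ p) zero    = refl
coeff--P (a ∷ p) (suc i) = coeff--P p i

∷-cong : ∀ {a b p p′} → a ≡ b → p ≋ p′ → a ∷ p ≋ b ∷ p′
∷-cong a≡b (mk≋ e) = mk≋ λ { zero → a≡b ; (suc i) → e i }

∷-≋[]⁻ : ∀ {a p} → a ∷ p ≋ [] → a ≡ 0ℤ
∷-≋[]⁻ (mk≋ e) = e zero

tail-≋[] : ∀ {a p} → a ∷ p ≋ [] → p ≋ []
tail-≋[] (mk≋ e) = mk≋ λ i → e (suc i)

0∷-≋[] : ∀ {p} → p ≋ [] → 0ℤ ∷ p ≋ []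
0∷-≋[] (mk≋ e) = mk≋ λ { zero → refl ; (suc i) → e i }

+P-cong : ∀ {p p′ s s′} → p ≋ p′ → s ≋ s′ → p +P s ≋ p′ +P s′
+P-cong {p} {p′} {s} {s′} (mk≋ e) (mk≋ f) = mk≋ λ i →
  trans (coeff-+P p s i) (trans (cong₂ ℤ._+_ (e i) (f i)) (sym (coeff-+P p′ s′ i)))

+P-comm : ∀ p s → p +P s ≋ s +P p
+P-comm p s = mk≋ λ i →
  trans (coeff-+P p s i) (trans (ℤₚ.+-comm (coeff p i) _) (sym (coeff-+P s p i)))

+P-assoc : ∀ p s t → (p +P s) +P t ≋ p +P (s +P t)
+P-assoc p s t = mk≋ λ i → begin
  coeff ((p +P s) +P t) i                   ≡⟨ coeff-+P (p +P s) t i ⟩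
  coeff (p +P s) i ℤ.+ coeff t i            ≡⟨ cong (ℤ._+ coeff t i) (coeff-+P p s i) ⟩
  coeff p i ℤ.+ coeff s i ℤ.+ coeff t i     ≡⟨ ℤₚ.+-assoc (coeff p i) _ _ ⟩
  coeff p i ℤ.+ (coeff s i ℤ.+ coeff t i)   ≡⟨ cong (λ z → coeff p i ℤ.+ z) (coeff-+P s t i) ⟨
  coeff p i ℤ.+ coeff (s +P t) i            ≡⟨ coeff-+P p (s +P t) i ⟨
  coeff (p +P (s +P t)) i                   ∎
  where open Relation.Binary.PropositionalEquality.≡-Reasoning

+P-inverseˡ : ∀ p → (-P p) +P p ≋ []
+P-inverseˡ p = mk≋ λ i →
  trans (coeff-+P (-P p) p i) (trans (cong (ℤ._+ coeff p i) (coeff--P p i)) (ℤₚ.+-inverseˡ (coeff p i)))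

-P-cong : ∀ {p p′} → p ≋ p′ → -P p ≋ -P p′
-P-cong {p} {p′} (mk≋ e) = mk≋ λ i → trans (coeff--P p i) (trans (cong ℤ.-_ (e i)) (sym (coeff--P p′ i)))

·P-cong : ∀ a {p p′} → p ≋ p′ → a ·P p ≋ a ·P p′
·P-cong a {p} {p′} (mk≋ e) = mk≋ λ i → trans (coeff-·P a p i) (trans (cong (a ℤ.*_) (e i)) (sym (coeff-·P a p′ i)))

·P-distrib-+P : ∀ a p s → a ·P (p +P s) ≋ (a ·P p) +P (a ·P s)
·P-distrib-+P a p s = mk≋ λ i →
  trans (coeff-·P a (p +P s) i) (trans (cong (a ℤ.*_) (coeff-+P p s i))
  (trans (ℤₚ.*-distribˡ-+ a _ _)
  (sym (trans (coeff-+P (a ·P p) (a ·P s) i) (cong₂ ℤ._+_ (coeff-·P a p i) (coeff-·P a s i))))))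

·P-assoc : ∀ a b p → a ·P (b ·P p) ≋ (a ℤ.* b) ·P p
·P-assoc a b p = mk≋ λ i →
  trans (coeff-·P a (b ·P p) i) (trans (cong (a ℤ.*_) (coeff-·P b p i))
  (trans (sym (ℤₚ.*-assoc a b _)) (sym (coeff-·P (a ℤ.* b) p i))))

·P-≋[] : ∀ {a} p → a ≡ 0ℤ → a ·P p ≋ []
·P-≋[] {a} p refl = mk≋ λ i → trans (coeff-·P 0ℤ p i) (ℤₚ.*-zeroˡ (coeff p i))

*P-zeroʳ : ∀ p → p *P [] ≋ []
*P-zeroʳ []      = ≋-refl
*P-zeroʳ (a ∷ p) = 0∷-≋[] (*P-zeroʳ p)

*P-≋[]ˡ : ∀ {p} s → p ≋ [] → p *P s ≋ []
*P-≋[]ˡ {[]}    s _   = ≋-refl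
*P-≋[]ˡ {a ∷ p} s p≋0 = +P-cong {s′ = []} (·P-≋[] s (∷-≋[]⁻ p≋0)) (0∷-≋[] (*P-≋[]ˡ s (tail-≋[] p≋0)))

*P-congˡ : ∀ {p p′} s → p ≋ p′ → p *P s ≋ p′ *P s
*P-congˡ {[]}    {[]}      s _ = ≋-refl
*P-congˡ {[]}    {a′ ∷ p′} s e = ≋-sym (*P-≋[]ˡ s (≋-sym e))
*P-congˡ {a ∷ p} {[]}      s e = *P-≋[]ˡ s e
*P-congˡ {a ∷ p} {a′ ∷ p′} s e@(mk≋ f) rewrite f zero =
  +P-cong ≋-refl (∷-cong refl (*P-congˡ s (tail-≋ e)))
  where
  tail-≋ : ∀ {a b p p′} → a ∷ p ≋ b ∷ p′ → p ≋ p′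
  tail-≋ (mk≋ g) = mk≋ λ i → g (suc i)

*P-congʳ : ∀ p {s s′} → s ≋ s′ → p *P s ≋ p *P s′
*P-congʳ []      e = ≋-refl
*P-congʳ (a ∷ p) e = +P-cong (·P-cong a e) (∷-cong refl (*P-congʳ p e))

*P-cong : ∀ {p p′ s s′} → p ≋ p′ → s ≋ s′ → p *P s ≋ p′ *P s′
*P-cong {p′ = p′} {s} e f = ≋-trans (*P-congˡ s e) (*P-congʳ p′ f)

*P-∷ʳ : ∀ p b s → p *P (b ∷ s) ≋ (b ·P p) +P (0ℤ ∷ (p *P s))
*P-∷ʳ []      b s = mk≋ λ { zero → refl ; (suc i) → refl }
*P-∷ʳ (a ∷ p) b s = ∷-cong (trans (ℤₚ.+-identityʳ _) (trans (ℤₚ.*-comm a b) (sym (ℤₚ.+-identityʳ _))))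
  (≋-trans (+P-cong (≋-refl {a ·P s}) (*P-∷ʳ p b s))
  (≋-trans (≋-sym (+P-assoc (a ·P s) (b ·P p) _))
  (≋-trans (+P-cong (+P-comm (a ·P s) (b ·P p)) ≋-refl)
  (+P-assoc (b ·P p) (a ·P s) _))))

*P-comm : ∀ p s → p *P s ≋ s *P p
*P-comm []      s = ≋-sym (*P-zeroʳ s)
*P-comm (a ∷ p) s = ≋-sym (≋-trans (*P-∷ʳ s a p) (+P-cong ≋-refl (∷-cong refl (*P-comm s p))))

*P-distribˡ : ∀ p s s′ → p *P (s +P s′) ≋ (p *P s) +P (p *P s′)
*P-distribˡ []      s s′ = ≋-refl
*P-distribˡ (a ∷ p) s s′ =
  ≋-trans (+P-cong (·P-distrib-+P a s s′) (∷-cong refl (*P-distribˡ p s s′)))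
          (+P-middleFour (a ·P s) (a ·P s′) (0ℤ ∷ (p *P s)) (0ℤ ∷ (p *P s′)))
  where
  open Consequences Poly-setoid using (comm∧assoc⇒middleFour)
  +P-middleFour : ∀ w x y z → (w +P x) +P (y +P z) ≋ (w +P y) +P (x +P z)
  +P-middleFour = comm∧assoc⇒middleFour +P-cong +P-comm +P-assoc

*P-distribʳ : ∀ s p p′ → (p +P p′) *P s ≋ (p *P s) +P (p′ *P s)
*P-distribʳ s p p′ = ≋-trans (*P-comm (p +P p′) s)
  (≋-trans (*P-distribˡ s p p′) (+P-cong (*P-comm s p) (*P-comm s p′)))

·P-*P : ∀ a s t → (a ·P s) *P t ≋ a ·P (s *P t)
·P-*P a []      t = ≋-refl
·P-*P a (b ∷ s) t =
  ≋-trans (+P-cong (≋-sym (·P-assoc a b t)) (∷-cong (sym (ℤₚ.*-zeroʳ a)) (·P-*P a s t)))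
          (≋-sym (·P-distrib-+P a (b ·P t) (0ℤ ∷ (s *P t))))

0∷-*P : ∀ p s → (0ℤ ∷ p) *P s ≋ 0ℤ ∷ (p *P s)
0∷-*P p s = +P-cong (·P-≋[] s refl) ≋-refl

*P-assoc : ∀ p s t → (p *P s) *P t ≋ p *P (s *P t)
*P-assoc []      s t = ≋-refl
*P-assoc (a ∷ p) s t =
  ≋-trans (*P-distribʳ t (a ·P s) (0ℤ ∷ (p *P s)))
          (+P-cong (·P-*P a s t) (≋-trans (0∷-*P (p *P s) t) (∷-cong refl (*P-assoc p s t))))

*P-identityˡ : ∀ p → 1P *P p ≋ p
*P-identityˡ p = mk≋ λ i →
  trans (coeff-+P (1ℤ ·P p) (0ℤ ∷ []) i)
  (trans (cong₂ ℤ._+_ (coeff-·P 1ℤ p i) (coeff-0∷[] i)) (trans (ℤₚ.+-identityʳ _) (ℤₚ.*-identityˡ _)))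
  where
  coeff-0∷[] : ∀ i → coeff (0ℤ ∷ []) i ≡ 0ℤ
  coeff-0∷[] zero    = refl
  coeff-0∷[] (suc i) = refl

Poly-isCommutativeRing : IsCommutativeRing _≋_ _+P_ _*P_ -P_ [] 1P
Poly-isCommutativeRing = record
  { isRing = record
    { +-isAbelianGroup = record
      { isGroup = record
        { isMonoid = record
          { isSemigroup = record
            { isMagma = record { isEquivalence = ≋-isEquivalence ; ∙-cong = +P-cong }
            ; assoc   = +P-assoc }
          ; identity = (λ _ → ≋-refl) , (λ p → +P-comm p []) }
        ; inverse = +P-inverseˡ , comm∧invˡ⇒invʳ +P-comm +P-inverseˡ
        ; ⁻¹-cong = -P-cong }
      ; comm = +P-comm }
    ; *-cong     = *P-cong
    ; *-assoc    = *P-assoc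
    ; *-identity = *P-identityˡ , (λ p → ≋-trans (*P-comm p 1P) (*P-identityˡ p))
    ; distrib    = *P-distribˡ , *P-distribʳ }
  ; *-comm = *P-comm }
  where open Consequences Poly-setoid using (comm∧invˡ⇒invʳ)

Poly-commutativeRing : CommutativeRing 0ℓ 0ℓ
Poly-commutativeRing = record { isCommutativeRing = Poly-isCommutativeRing }

Poly-ring : ACR.AlmostCommutativeRing 0ℓ 0ℓ
Poly-ring = ACR.fromCommutativeRing Poly-commutativeRing λ { [] → just ≋-refl ; (_ ∷ _) → nothing }

*P-noZeroDivisors : ∀ d p → ¬ d ≋ [] → d *P p ≋ [] → p ≋ []
*P-noZeroDivisors []      p d≉0 _ = ⊥-elim (d≉0 ≋-refl)
*P-noZeroDivisors (a ∷ d) p d≉0 dp≋0 with a ℤ.≟ 0ℤ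
... | yes refl = *P-noZeroDivisors d p (λ d≋0 → d≉0 (0∷-≋[] d≋0))
                   (tail-≋[] (≋-trans (≋-sym (0∷-*P d p)) dp≋0))
... | no a≢0 = noZeroDivisors p dp≋0
  where
  noZeroDivisors : ∀ p → (a ∷ d) *P p ≋ [] → p ≋ []
  noZeroDivisors []      _    = ≋-refl
  noZeroDivisors (b ∷ p) e with ℤₚ.i*j≡0⇒i≡0∨j≡0 a (trans (sym (ℤₚ.+-identityʳ _)) (coeff-≡ e zero))
  ... | inj₁ a≡0 = ⊥-elim (a≢0 a≡0)
  ... | inj₂ refl = 0∷-≋[] (noZeroDivisors p (tail-≋[] (≋-trans shift e)))
    where
    shift : 0ℤ ∷ ((a ∷ d) *P p) ≋ (a ∷ d) *P (0ℤ ∷ p)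
    shift = ≋-sym (≋-trans (*P-∷ʳ (a ∷ d) 0ℤ p) (+P-cong (·P-≋[] (a ∷ d) refl) ≋-refl))

open AlgebraDefinitions _≋_ using (AlmostLeftCancellative)

*P-almostCancelˡ : AlmostLeftCancellative [] _*P_
*P-almostCancelˡ d p p′ d≉0 dp≋dp′ =
  x∙y⁻¹≈ε⇒x≈y p p′ (*P-noZeroDivisors d (p +P (-P p′)) d≉0 (≋-trans (distribute d p p′)
    (≋-trans (+P-cong dp≋dp′ ≋-refl) (≋-trans (+P-comm (d *P p′) (-P (d *P p′))) (+P-inverseˡ (d *P p′))))))
  where
  open import Algebra.Properties.Group (CommutativeRing.+-group Poly-commutativeRing) using (x∙y⁻¹≈ε⇒x≈y)
  distribute : ∀ d p p′ → d *P (p +P (-P p′)) ≋ (d *P p) +P (-P (d *P p′))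
  distribute = solve-∀ Poly-ring

-- The field of fractions ℚ(q)

-- Cross-multiplication is transitive only through fractions with nonzero denominator.
record ℚ⟨q⟩ : Set where
  constructor _,_
  field
    value : Frac
    den≉0 : NonZeroDen value
open ℚ⟨q⟩

infix 4 _≈Q_
record _≈Q_ (x y : ℚ⟨q⟩) : Set where
  constructor mk≈Q
  field cross-≋ : num (value x) *P den (value y) ≋ num (value y) *P den (value x)
open _≈Q_

NonZeroPoly : Poly → Set
NonZeroPoly d = ¬ d ≈P []

*P-nonzero : ∀ d d′ → NonZeroPoly d → NonZeroPoly d′ → NonZeroPoly (d *P d′)
*P-nonzero d d′ d≉0 d′≉0 dd′≈0 =
  d′≉0 (coeff-≡ (*P-noZeroDivisors d d′ (λ e → d≉0 (coeff-≡ e)) (mk≋ dd′≈0)))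

1≉0 : NonZeroDen 1F
1≉0 e with e zero
... | ()

_+Q_ _*Q_ : ℚ⟨q⟩ → ℚ⟨q⟩ → ℚ⟨q⟩
(x , x≉0) +Q (y , y≉0) = x +F y , *P-nonzero (den x) (den y) x≉0 y≉0
(x , x≉0) *Q (y , y≉0) = x *F y , *P-nonzero (den x) (den y) x≉0 y≉0

0Q 1Q : ℚ⟨q⟩
0Q = 0F , 1≉0
1Q = 1F , 1≉0

≈Q-refl : ∀ {x} → x ≈Q x
≈Q-refl = mk≈Q ≋-refl

≈Q-isEquivalence : IsEquivalence _≈Q_
≈Q-isEquivalence = record
  { refl  = ≈Q-refl
  ; sym   = λ (mk≈Q e) → mk≈Q (≋-sym e)
  ; trans = ≈Q-trans
  }
  where
  ≈Q-trans : ∀ {x y z} → x ≈Q y → y ≈Q z → x ≈Q z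
  ≈Q-trans {frac a b , _} {frac c d , d≉0} {frac e f , _} (mk≈Q ad≋cb) (mk≈Q cf≋ed) =
    mk≈Q (*P-almostCancelˡ d (a *P f) (e *P b) (λ e → d≉0 (coeff-≡ e)) (begin
      d *P (a *P f)   ≈⟨ shuffle a d f ⟩
      (a *P d) *P f   ≈⟨ *P-cong ad≋cb ≋-refl ⟩
      (c *P b) *P f   ≈⟨ swap c b f ⟩
      (c *P f) *P b   ≈⟨ *P-cong cf≋ed ≋-refl ⟩
      (e *P d) *P b   ≈⟨ unshuffle e d b ⟩
      d *P (e *P b)   ∎))
    where
    open import Relation.Binary.Reasoning.Setoid Poly-setoid
    shuffle : ∀ a d f → d *P (a *P f) ≋ (a *P d) *P f
    shuffle = solve-∀ Poly-ring
    swap : ∀ c b f → (c *P b) *P f ≋ (c *P f) *P b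
    swap = solve-∀ Poly-ring
    unshuffle : ∀ e d b → (e *P d) *P b ≋ d *P (e *P b)
    unshuffle = solve-∀ Poly-ring

+Q-cong : ∀ {x x′ y y′} → x ≈Q x′ → y ≈Q y′ → (x +Q y) ≈Q (x′ +Q y′)
+Q-cong {frac a b , _} {frac a′ b′ , _} {frac c d , _} {frac c′ d′ , _} (mk≈Q ab′≋a′b) (mk≈Q cd′≋c′d) =
  mk≈Q (begin
    ((a *P d) +P (c *P b)) *P (b′ *P d′)                    ≈⟨ expand a d c b b′ d′ ⟩
    ((a *P b′) *P (d *P d′)) +P ((c *P d′) *P (b *P b′))
      ≈⟨ +P-cong (*P-cong ab′≋a′b ≋-refl) (*P-cong cd′≋c′d ≋-refl) ⟩
    ((a′ *P b) *P (d *P d′)) +P ((c′ *P d) *P (b *P b′))    ≈⟨ collect a′ b d d′ c′ b′ ⟩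
    ((a′ *P d′) +P (c′ *P b′)) *P (b *P d)                  ∎)
  where
  open import Relation.Binary.Reasoning.Setoid Poly-setoid
  expand : ∀ a d c b b′ d′ → (((a *P d) +P (c *P b)) *P (b′ *P d′))
                           ≋ (((a *P b′) *P (d *P d′)) +P ((c *P d′) *P (b *P b′)))
  expand = solve-∀ Poly-ring
  collect : ∀ a′ b d d′ c′ b′ → (((a′ *P b) *P (d *P d′)) +P ((c′ *P d) *P (b *P b′)))
                               ≋ (((a′ *P d′) +P (c′ *P b′)) *P (b *P d))
  collect = solve-∀ Poly-ring

*Q-cong : ∀ {x x′ y y′} → x ≈Q x′ → y ≈Q y′ → (x *Q y) ≈Q (x′ *Q y′)
*Q-cong {frac a b , _} {frac a′ b′ , _} {frac c d , _} {frac c′ d′ , _} (mk≈Q ab′≋a′b) (mk≈Q cd′≋c′d) =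
  mk≈Q (≋-trans (middle a c b′ d′) (≋-trans (*P-cong ab′≋a′b cd′≋c′d) (middle a′ b c′ d)))
  where
  middle : ∀ a c b′ d′ → ((a *P c) *P (b′ *P d′)) ≋ ((a *P b′) *P (c *P d′))
  middle = solve-∀ Poly-ring

+Q-assoc : ∀ x y z → ((x +Q y) +Q z) ≈Q (x +Q (y +Q z))
+Q-assoc (frac a b , _) (frac c d , _) (frac e f , _) = mk≈Q (law a b c d e f)
  where
  law : ∀ a b c d e f → (((((a *P d) +P (c *P b)) *P f) +P (e *P (b *P d))) *P (b *P (d *P f)))
                      ≋ (((a *P (d *P f)) +P (((c *P f) +P (e *P d)) *P b)) *P ((b *P d) *P f))
  law = solve-∀ Poly-ring

+Q-comm : ∀ x y → (x +Q y) ≈Q (y +Q x)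
+Q-comm (frac a b , _) (frac c d , _) = mk≈Q (law a b c d)
  where
  law : ∀ a b c d → (((a *P d) +P (c *P b)) *P (d *P b)) ≋ (((c *P b) +P (a *P d)) *P (b *P d))
  law = solve-∀ Poly-ring

+Q-identityˡ : ∀ x → (0Q +Q x) ≈Q x
+Q-identityˡ (frac a b , _) = mk≈Q (law a b)
  where
  law : ∀ a b → ((([] *P b) +P (a *P 1P)) *P b) ≋ (a *P (1P *P b))
  law = solve-∀ Poly-ring

*Q-assoc : ∀ x y z → ((x *Q y) *Q z) ≈Q (x *Q (y *Q z))
*Q-assoc (frac a b , _) (frac c d , _) (frac e f , _) = mk≈Q (law a b c d e f)
  where
  law : ∀ a b c d e f → (((a *P c) *P e) *P (b *P (d *P f))) ≋ ((a *P (c *P e)) *P ((b *P d) *P f))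
  law = solve-∀ Poly-ring

*Q-comm : ∀ x y → (x *Q y) ≈Q (y *Q x)
*Q-comm (frac a b , _) (frac c d , _) = mk≈Q (law a b c d)
  where
  law : ∀ a b c d → ((a *P c) *P (d *P b)) ≋ ((c *P a) *P (b *P d))
  law = solve-∀ Poly-ring

*Q-identityˡ : ∀ x → (1Q *Q x) ≈Q x
*Q-identityˡ (frac a b , _) = mk≈Q (law a b)
  where
  law : ∀ a b → ((1P *P a) *P b) ≋ (a *P (1P *P b))
  law = solve-∀ Poly-ring

*Q-distribʳ : ∀ x y z → ((y +Q z) *Q x) ≈Q ((y *Q x) +Q (z *Q x))
*Q-distribʳ (frac a b , _) (frac c d , _) (frac e f , _) = mk≈Q (law a b c d e f)
  where
  law : ∀ a b c d e f → ((((c *P f) +P (e *P d)) *P a) *P ((d *P b) *P (f *P b)))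
                      ≋ ((((c *P a) *P (f *P b)) +P ((e *P a) *P (d *P b))) *P ((d *P f) *P b))
  law = solve-∀ Poly-ring

*Q-zeroˡ : ∀ x → (0Q *Q x) ≈Q 0Q
*Q-zeroˡ (frac a b , _) = mk≈Q (law a b)
  where
  law : ∀ a b → (([] *P a) *P 1P) ≋ ([] *P (1P *P b))
  law = solve-∀ Poly-ring

ℚ⟨q⟩-commutativeSemiring : CommutativeSemiring 0ℓ 0ℓ
ℚ⟨q⟩-commutativeSemiring = record
  { _+_ = _+Q_
  ; _*_ = _*Q_
  ; 0#  = 0Q
  ; 1#  = 1Q
  ; isCommutativeSemiring = isCommutativeSemiringˡ record
    { +-isCommutativeMonoid = isCommutativeMonoidˡ record
      { isSemigroup = record
        { isMagma = record { isEquivalence = ≈Q-isEquivalence ; ∙-cong = +Q-cong }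
        ; assoc   = +Q-assoc }
      ; identityˡ = +Q-identityˡ
      ; comm      = +Q-comm }
    ; *-isCommutativeMonoid = isCommutativeMonoidˡ record
      { isSemigroup = record
        { isMagma = record { isEquivalence = ≈Q-isEquivalence ; ∙-cong = *Q-cong }
        ; assoc   = *Q-assoc }
      ; identityˡ = *Q-identityˡ
      ; comm      = *Q-comm }
    ; distribʳ = *Q-distribʳ
    ; zeroˡ    = *Q-zeroˡ } }

module Blocks (d : ℕ × List (ℕ × ℕ)) where

  open import Data.Nat using (_+_)


  l : ℕ
  l = length (proj₂ d)

  a b : ℕ → ℕ
  a zero    = 0
  a (suc i) = proj₁ (nth (proj₂ d) i)
  b zero    = proj₁ d
  b (suc i) = proj₂ (nth (proj₂ d) i)

  c : ℕ → ℕ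
  c k = sumR a 1 k + sumR b 0 k + 1

  φ-before φ-after φ : ℕ → Frac
  φ-before k = prodR (λ i → qint (sumR a (suc i) k + sumR b i k) ÷P qint (sumR a i k + sumR b i k)) 1 k
  φ-after  k = prodR (λ i → qint (sumR a (suc k) i + sumR b (suc k) (i ∸ 1))
                             ÷P qint (sumR a (suc k) i + sumR b (suc k) i)) (suc k) l
  φ k = polyF (qpow (sumR a 1 k)) *F (φ-before k *F φ-after k)

  terms : ℕ → Tab → V
  terms n T = map (λ k → φ k , addTop (c k) (suc n) T) (applyUpTo id (suc l))

-- The local a and b of ΩT agree with Blocks.a and Blocks.b only pointwise.
ΩT-blocks : ∀ r n T → ΩT r n T ≡ Blocks.terms (decomp (δseq r n T)) n T
ΩT-blocks r n T = map-cong (λ k → cong₂ _,_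
    (cong₂ _*F_ (cong (polyF ∘ qpow) (a≗ 1 k))
      (cong₂ _*F_ (prodR-cong (λ i → cong₂ _÷P_ (cong qint (cong₂ ℕ._+_ (a≗ (suc i) k) (b≗ i k)))
                                                 (cong qint (cong₂ ℕ._+_ (a≗ i k) (b≗ i k)))) 1 k)
                  (prodR-cong (λ i → cong₂ _÷P_ (cong qint (cong₂ ℕ._+_ (a≗ (suc k) i) (b≗ (suc k) (i ℕ.∸ 1))))
                                                 (cong qint (cong₂ ℕ._+_ (a≗ (suc k) i) (b≗ (suc k) i)))) (suc k) l)))
    (cong (λ z → addTop (z ℕ.+ 1) (suc n) T) (cong₂ ℕ._+_ (a≗ 1 k) (b≗ 0 k))))
  (applyUpTo id (suc l))
  where
  open Blocks (decomp (δseq r n T))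
  sumR-cong : ∀ {f g : ℕ → ℕ} → (∀ x → f x ≡ g x) → ∀ lo hi → sumR f lo hi ≡ sumR g lo hi
  sumR-cong f≗g lo hi = cong sum (map-cong f≗g (range lo hi))
  prodR-cong : ∀ {f g : ℕ → Frac} → (∀ x → f x ≡ g x) → ∀ lo hi → prodR f lo hi ≡ prodR g lo hi
  prodR-cong f≗g lo hi = cong prodF (map-cong f≗g (range lo hi))
  a≗ : ∀ lo hi → sumR _ lo hi ≡ sumR a lo hi
  a≗ = sumR-cong λ { zero → refl ; (suc i) → refl }
  b≗ : ∀ lo hi → sumR _ lo hi ≡ sumR b lo hi
  b≗ = sumR-cong λ { zero → refl ; (suc i) → refl }

-- For r < m < n, Ω_r commutes with τ_m

swapLabel-≢ : ∀ m x → x ≢ m → x ≢ suc m → swapLabel m x ≡ x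
swapLabel-≢ m x x≢m x≢1+m with x ℕ.≟ m | x ℕ.≟ suc m
... | yes x≡m | _         = contradiction x≡m x≢m
... | no _    | yes x≡1+m = contradiction x≡1+m x≢1+m
... | no _    | no _      = refl

isColored-> : ∀ {r x} → r < x → isColored r (just x) ≡ true
isColored-> {r} {x} r<x with r ℕ.<? x
... | yes _   = refl
... | no r≮x = contradiction r<x r≮x

isColored-swapLabel : ∀ {r m} → r < m → ∀ x → isColored r (just (swapLabel m x)) ≡ isColored r (just x)
isColored-swapLabel {r} {m} r<m x with x ℕ.≟ m | x ℕ.≟ suc m
... | yes refl | _         = trans (isColored-> (ℕₚ.m<n⇒m<1+n r<m)) (sym (isColored-> r<m))
... | no _     | yes refl  = trans (isColored-> r<m) (sym (isColored-> (ℕₚ.m<n⇒m<1+n r<m)))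
... | no _     | no _      = refl

column-τ : ∀ m T i → column (τ m T) i ≡ map (swapLabel m) (column T i)
column-τ m T        zero          = refl
column-τ m []       (suc i)       = refl
column-τ m (c ∷ cs) (suc zero)    = refl
column-τ m (c ∷ cs) (suc (suc i)) = column-τ m cs (suc i)

top-τ : ∀ m T i → top (τ m T) i ≡ Maybe.map (swapLabel m) (top T i)
top-τ m T i = trans (cong last (column-τ m T i)) (last-map (swapLabel m) (column T i))

isColored-top-τ : ∀ {r m} → r < m → ∀ T i → isColored r (top (τ m T) i) ≡ isColored r (top T i)
isColored-top-τ {m = m} r<m T i rewrite top-τ m T i with top T i
... | nothing = refl
... | just x  = isColored-swapLabel r<m x

applyUpTo-cong : ∀ {A : Set} {f g : ℕ → A} → (∀ i → f i ≡ g i) → ∀ n → applyUpTo f n ≡ applyUpTo g n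
applyUpTo-cong f≗g zero    = refl
applyUpTo-cong f≗g (suc n) = cong₂ _∷_ (f≗g 0) (applyUpTo-cong (f≗g ∘ suc) n)

δseq-τ : ∀ {r m} → r < m → ∀ n T → δseq r n (τ m T) ≡ δseq r n T
δseq-τ r<m n T = applyUpTo-cong (λ i → isColored-top-τ r<m T (suc i)) (suc n)

swapLabel-new : ∀ {m n} → m < n → swapLabel m (suc n) ≡ suc n
swapLabel-new m<n = swapLabel-≢ _ _ (λ e → ℕₚ.<-irrefl (sym e) (ℕₚ.m<n⇒m<1+n m<n))
                                    (λ e → ℕₚ.<-irrefl (sym e) (s≤s m<n))

addTop-τ : ∀ {m n} → m < n → ∀ j T → addTop j (suc n) (τ m T) ≡ τ m (addTop j (suc n) T)
addTop-τ m<n zero          T        = refl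
addTop-τ m<n (suc zero)    []       = cong (λ x → (x ∷ []) ∷ []) (sym (swapLabel-new m<n))
addTop-τ m<n (suc zero)    (c ∷ cs) =
  cong (_∷ _) (trans (cong (λ x → map _ c ++ x ∷ []) (sym (swapLabel-new m<n))) (sym (map-++ _ c _)))
addTop-τ m<n (suc (suc i)) []       = cong ([] ∷_) (addTop-τ m<n (suc i) [])
addTop-τ m<n (suc (suc i)) (c ∷ cs) = cong (_ ∷_) (addTop-τ m<n (suc i) cs)

-- τ_m only exchanges two coloured labels, and it fixes the new label n+1.
ΩT-τ : ∀ {r m n} → r < m → m < n → ∀ T →
       ΩT r n (τ m T) ≡ map (λ e → proj₁ e , τ m (proj₂ e)) (ΩT r n T)
ΩT-τ {r} {m} {n} r<m m<n T = begin
  ΩT r n (τ m T)                                     ≡⟨ ΩT-blocks r n (τ m T) ⟩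
  Blocks.terms (decomp (δseq r n (τ m T))) n (τ m T) ≡⟨ cong (λ δ → Blocks.terms (decomp δ) n (τ m T)) (δseq-τ r<m n T) ⟩
  Blocks.terms d n (τ m T)                           ≡⟨ map-cong (λ k → cong (φ k ,_) (addTop-τ m<n (c k) T)) ks ⟩
  map (λ k → φ k , τ m (addTop (c k) (suc n) T)) ks  ≡⟨ map-∘ ks ⟩
  map (λ e → proj₁ e , τ m (proj₂ e)) (Blocks.terms d n T) ≡⟨ cong (map _) (ΩT-blocks r n T) ⟨
  map (λ e → proj₁ e , τ m (proj₂ e)) (ΩT r n T)      ∎
  where
  open Relation.Binary.PropositionalEquality.≡-Reasoning
  d = decomp (δseq r n T)
  open Blocks d using (φ; c; l)
  ks = applyUpTo id (suc l)

-- The block decomposition of a colour sequence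

module _ where
  open import Data.Nat using (_+_)
  open import Data.Nat.Tactic.RingSolver using () renaming (solve-∀ to ℕ-solve-∀)

  expand : List (Bool × ℕ) → List Bool
  expand []             = []
  expand ((x , k) ∷ rs) = replicate k x ++ expand rs

  expand-rle : ∀ xs → expand (rle xs) ≡ xs
  expand-rle []       = refl
  expand-rle (x ∷ xs) with rle xs | expand-rle xs
  ... | []                   | e = cong (x ∷_) e
  expand-rle (true  ∷ xs) | (true  , k) ∷ rs | e = cong (true ∷_) e
  expand-rle (true  ∷ xs) | (false , k) ∷ rs | e = cong (true ∷_) e
  expand-rle (false ∷ xs) | (true  , k) ∷ rs | e = cong (false ∷_) e
  expand-rle (false ∷ xs) | (false , k) ∷ rs | e = cong (false ∷_) e

  PositiveRun : Bool × ℕ → Set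
  PositiveRun run = 1 ≤ proj₂ run

  rle-positive : ∀ xs → All PositiveRun (rle xs)
  rle-positive []       = []
  rle-positive (x ∷ xs) with rle xs | rle-positive xs
  ... | []  | _ = s≤s z≤n ∷ []
  rle-positive (true  ∷ xs) | (true  , k) ∷ rs | p ∷ ps = s≤s z≤n ∷ ps
  rle-positive (true  ∷ xs) | (false , k) ∷ rs | p ∷ ps = s≤s z≤n ∷ p ∷ ps
  rle-positive (false ∷ xs) | (true  , k) ∷ rs | p ∷ ps = s≤s z≤n ∷ p ∷ ps
  rle-positive (false ∷ xs) | (false , k) ∷ rs | p ∷ ps = s≤s z≤n ∷ ps

  Alternating : List (Bool × ℕ) → Set
  Alternating []           = ⊤
  Alternating (_ ∷ [])     = ⊤
  Alternating (p ∷ q ∷ rs) = proj₁ q ≡ not (proj₁ p) × Alternating (q ∷ rs)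

  rle-alternating : ∀ xs → Alternating (rle xs)
  rle-alternating []       = tt
  rle-alternating (x ∷ xs) with rle xs | rle-alternating xs
  ... | [] | _ = tt
  rle-alternating (true  ∷ xs) | (true  , k) ∷ []     | _   = tt
  rle-alternating (true  ∷ xs) | (true  , k) ∷ _ ∷ _  | alt = alt
  rle-alternating (true  ∷ xs) | (false , k) ∷ _      | alt = refl , alt
  rle-alternating (false ∷ xs) | (true  , k) ∷ _      | alt = refl , alt
  rle-alternating (false ∷ xs) | (false , k) ∷ []     | _   = tt
  rle-alternating (false ∷ xs) | (false , k) ∷ _ ∷ _  | alt = alt

  blocks : List (ℕ × ℕ) → List Bool
  blocks []             = []
  blocks ((a , b) ∷ ps) = replicate a false ++ replicate b true ++ blocks ps

  PositiveBlock : ℕ × ℕ → Set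
  PositiveBlock ab = 1 ≤ proj₁ ab × 1 ≤ proj₂ ab

  TrailingZeros : List (Bool × ℕ) → Set
  TrailingZeros rs = rs ≡ [] ⊎ Σ ℕ λ a → 1 ≤ a × rs ≡ (false , a) ∷ []

  afterPairs : List (Bool × ℕ) → List (Bool × ℕ)
  afterPairs ((false , a) ∷ (true , b) ∷ rs) = afterPairs rs
  afterPairs rs                              = rs

  StartsWithFalse : List (Bool × ℕ) → Set
  StartsWithFalse []             = ⊤
  StartsWithFalse ((x , _) ∷ _) = x ≡ false

  alternating-tail : ∀ {p} rs → Alternating (p ∷ rs) → Alternating rs
  alternating-tail []      _         = tt
  alternating-tail (_ ∷ _) (_ , alt) = alt

  alternating-after-true : ∀ {k} rs → Alternating ((true , k) ∷ rs) → StartsWithFalse rs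
  alternating-after-true []      _       = tt
  alternating-after-true (_ ∷ _) (x , _) = x

  pairsAB-spec : ∀ rs → Alternating rs → StartsWithFalse rs → All PositiveRun rs →
                 expand rs ≡ blocks (pairsAB rs) ++ expand (afterPairs rs)
                 × TrailingZeros (afterPairs rs) × All PositiveBlock (pairsAB rs)
  pairsAB-spec [] _ _ _ = refl , inj₁ refl , []
  pairsAB-spec ((false , a) ∷ []) _ _ (a≥1 ∷ _) = refl , inj₂ (a , a≥1 , refl) , []
  pairsAB-spec ((false , a) ∷ (true , b) ∷ rs) (_ , alt) _ (a≥1 ∷ b≥1 ∷ ps)
    with pairsAB-spec rs (alternating-tail rs alt) (alternating-after-true rs alt) ps
  ... | e , zeros , pos =
    trans (cong (λ xs → replicate a false ++ replicate b true ++ xs) e)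
          (sym (trans (++-assoc (replicate a false) _ _) (cong (replicate a false ++_) (++-assoc (replicate b true) _ _))))
    , zeros , (a≥1 , b≥1) ∷ pos
  pairsAB-spec ((false , a) ∷ (false , b) ∷ rs) (() , _) _ _
  pairsAB-spec ((true , a) ∷ rs) _ () _

  record BlockDecomposition (δs : List Bool) (d : ℕ × List (ℕ × ℕ)) : Set where
    field
      rest            : List (Bool × ℕ)
      rest-zeros      : TrailingZeros rest
      δs≡             : δs ≡ replicate (proj₁ d) true ++ blocks (proj₂ d) ++ expand rest
      blocks-positive : All PositiveBlock (proj₂ d)

  decompRuns : List (Bool × ℕ) → ℕ × List (ℕ × ℕ)
  decompRuns ((true , b) ∷ rs) = b , pairsAB rs
  decompRuns rs                = 0 , pairsAB rs

  decomp-runs : ∀ δs → decomp δs ≡ decompRuns (rle δs)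
  decomp-runs δs with rle δs
  ... | []               = refl
  ... | (true  , _) ∷ _ = refl
  ... | (false , _) ∷ _ = refl

  decompRuns-spec : ∀ rs → Alternating rs → All PositiveRun rs → BlockDecomposition (expand rs) (decompRuns rs)
  decompRuns-spec [] _ _ = record { rest = [] ; rest-zeros = inj₁ refl ; δs≡ = refl ; blocks-positive = [] }
  decompRuns-spec ((true , b) ∷ rs) alt (_ ∷ ps)
    with pairsAB-spec rs (alternating-tail rs alt) (alternating-after-true rs alt) ps
  ... | e , zeros , pos = record
    { rest = afterPairs rs ; rest-zeros = zeros ; δs≡ = cong (replicate b true ++_) e ; blocks-positive = pos }
  decompRuns-spec ((false , a) ∷ rs) alt ps with pairsAB-spec ((false , a) ∷ rs) alt refl ps
  ... | e , zeros , pos = record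
    { rest = afterPairs ((false , a) ∷ rs) ; rest-zeros = zeros ; δs≡ = e ; blocks-positive = pos }

  decomp-spec : ∀ δs → BlockDecomposition δs (decomp δs)
  decomp-spec δs rewrite decomp-runs δs =
    subst (λ xs → BlockDecomposition xs (decompRuns (rle δs))) (expand-rle δs)
          (decompRuns-spec (rle δs) (rle-alternating δs) (rle-positive δs))

  NoTrailingFalse : List Bool → Set
  NoTrailingFalse xs = xs ≡ [] ⊎ Σ (List Bool) λ ys → xs ≡ ys ++ true ∷ []

  replicate-∷ʳ : ∀ {A : Set} n (x : A) → replicate (suc n) x ≡ replicate n x ++ x ∷ []
  replicate-∷ʳ zero    x = refl
  replicate-∷ʳ (suc n) x = cong (x ∷_) (replicate-∷ʳ n x)

  replicate-true-noTrailingFalse : ∀ b → NoTrailingFalse (replicate b true)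
  replicate-true-noTrailingFalse zero    = inj₁ refl
  replicate-true-noTrailingFalse (suc b) = inj₂ (replicate b true , replicate-∷ʳ b true)

  ++-blocks-noTrailingFalse : ∀ ys ps → NoTrailingFalse ys → All PositiveBlock ps → NoTrailingFalse (ys ++ blocks ps)
  ++-blocks-noTrailingFalse ys [] ys-ok _ = subst NoTrailingFalse (sym (++-identityʳ ys)) ys-ok
  ++-blocks-noTrailingFalse ys ((a , suc b) ∷ ps) _ (_ ∷ pos) =
    subst NoTrailingFalse reassociate (++-blocks-noTrailingFalse zs ps (inj₂ (ys′ ++ replicate b true , ends-true)) pos)
    where
    ys′ = ys ++ replicate a false
    zs  = ys′ ++ replicate (suc b) true
    ends-true : zs ≡ (ys′ ++ replicate b true) ++ true ∷ []
    ends-true = trans (cong (ys′ ++_) (replicate-∷ʳ b true)) (sym (++-assoc ys′ (replicate b true) _))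
    reassociate : zs ++ blocks ps ≡ ys ++ blocks ((a , suc b) ∷ ps)
    reassociate = trans (++-assoc ys′ _ _) (++-assoc ys _ _)

  noTrailingFalse-∷ʳ-false : ∀ {xs} ys → NoTrailingFalse xs → xs ≢ ys ++ false ∷ []
  noTrailingFalse-∷ʳ-false []      (inj₁ refl) ()
  noTrailingFalse-∷ʳ-false (_ ∷ _) (inj₁ refl) ()
  noTrailingFalse-∷ʳ-false ys      (inj₂ (zs , refl)) e with ∷ʳ-injectiveʳ zs ys e
  ... | ()

  blocks-take-drop : ∀ k ps → blocks ps ≡ blocks (take k ps) ++ blocks (drop k ps)
  blocks-take-drop zero    ps             = refl
  blocks-take-drop (suc k) []             = refl
  blocks-take-drop (suc k) ((a , b) ∷ ps) =
    trans (cong (λ xs → replicate a false ++ replicate b true ++ xs) (blocks-take-drop k ps))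
          (sym (trans (++-assoc (replicate a false) _ _) (cong (replicate a false ++_) (++-assoc (replicate b true) _ _))))

  length-blocks : ∀ ps → length (blocks ps) ≡ sum (map proj₁ ps) + sum (map proj₂ ps)
  length-blocks []             = refl
  length-blocks ((a , b) ∷ ps) = begin
    length (replicate a false ++ replicate b true ++ blocks ps)
      ≡⟨ length-++ (replicate a false) ⟩
    length (replicate a false) + length (replicate b true ++ blocks ps)
      ≡⟨ cong₂ _+_ (length-replicate a) (length-++ (replicate b true)) ⟩
    a + (length (replicate b true) + length (blocks ps))
      ≡⟨ cong (λ x → a + (x + length (blocks ps))) (length-replicate b) ⟩
    a + (b + length (blocks ps))
      ≡⟨ cong (λ x → a + (b + x)) (length-blocks ps) ⟩
    a + (b + (sum (map proj₁ ps) + sum (map proj₂ ps)))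
      ≡⟨ regroup a b (sum (map proj₁ ps)) (sum (map proj₂ ps)) ⟩
    a + sum (map proj₁ ps) + (b + sum (map proj₂ ps))
      ∎
    where
    open Relation.Binary.PropositionalEquality.≡-Reasoning
    regroup : ∀ a b x y → a + (b + (x + y)) ≡ a + x + (b + y)
    regroup = ℕ-solve-∀

  sum-applyUpTo-nth : ∀ (f : ℕ × ℕ → ℕ) k ps → k ≤ length ps →
                      sum (applyUpTo (λ j → f (nth ps j)) k) ≡ sum (map f (take k ps))
  sum-applyUpTo-nth f zero    ps       _         = refl
  sum-applyUpTo-nth f (suc k) (p ∷ ps) (s≤s k≤l) = cong (f p +_) (sum-applyUpTo-nth f k ps k≤l)

  c-length : ∀ d k → k ≤ Blocks.l d →
             Blocks.c d k ≡ suc (length (replicate (proj₁ d) true ++ blocks (take k (proj₂ d))))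
  c-length d k k≤l = begin
    sumR a 1 k + sumR b 0 k + 1
      ≡⟨ cong₂ (λ x y → x + y + 1) (cong sum (map-applyUpTo suc a k))
                                   (cong (λ xs → proj₁ d + sum xs) (map-applyUpTo suc b k)) ⟩
    sum (applyUpTo (a ∘ suc) k) + (proj₁ d + sum (applyUpTo (b ∘ suc) k)) + 1
      ≡⟨ cong₂ (λ x y → x + (proj₁ d + y) + 1) (sum-applyUpTo-nth proj₁ k ps k≤l)
                                               (sum-applyUpTo-nth proj₂ k ps k≤l) ⟩
    sum (map proj₁ (take k ps)) + (proj₁ d + sum (map proj₂ (take k ps))) + 1
      ≡⟨ regroup (sum (map proj₁ (take k ps))) (proj₁ d) (sum (map proj₂ (take k ps))) ⟩
    suc (proj₁ d + (sum (map proj₁ (take k ps)) + sum (map proj₂ (take k ps))))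
      ≡⟨ cong (λ x → suc (proj₁ d + x)) (length-blocks (take k ps)) ⟨
    suc (proj₁ d + length (blocks (take k ps)))
      ≡⟨ cong (λ x → suc (x + length (blocks (take k ps)))) (length-replicate (proj₁ d)) ⟨
    suc (length (replicate (proj₁ d) true) + length (blocks (take k ps)))
      ≡⟨ cong suc (length-++ (replicate (proj₁ d) true)) ⟨
    suc (length (replicate (proj₁ d) true ++ blocks (take k ps)))
      ∎
    where
    open Relation.Binary.PropositionalEquality.≡-Reasoning
    open Blocks d using (a; b)
    ps = proj₂ d
    regroup : ∀ x b₀ y → x + (b₀ + y) + 1 ≡ suc (b₀ + (x + y))
    regroup = ℕ-solve-∀

  record InsertionPoint (δs : List Bool) (c : ℕ) : Set where
    field
      before after : List Bool
      δs≡          : δs ≡ before ++ false ∷ after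
      c≡           : c ≡ suc (length before)
      before-ok    : NoTrailingFalse before

  blocks-then-zeros : ∀ ps a → 1 ≤ a → All PositiveBlock ps →
                      Σ (List Bool) λ after → blocks ps ++ replicate a false ++ [] ≡ false ∷ after
  blocks-then-zeros []                    (suc a) _ _               = _ , refl
  blocks-then-zeros ((suc a′ , b) ∷ ps)   a       _ _               = _ , refl
  blocks-then-zeros ((zero , b) ∷ ps)     a       _ ((() , _) ∷ _)

  -- c_k - 1 is the length of 1^{b_0} 0^{a_1} 1^{b_1} … 0^{a_k} 1^{b_k}, which is followed by a 0
  -- because δ ends with 0.
  insertionPoint : ∀ δs ys → δs ≡ ys ++ false ∷ [] → ∀ k → k ≤ Blocks.l (decomp δs) →
                   InsertionPoint δs (Blocks.c (decomp δs) k)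
  insertionPoint δs ys δs-ends-false k k≤l with decomp-spec δs
  ... | record { rest-zeros = inj₁ refl ; δs≡ = δs≡ ; blocks-positive = pos } =
    contradiction (trans (sym δs≡′) δs-ends-false)
      (noTrailingFalse-∷ʳ-false ys (++-blocks-noTrailingFalse (replicate b₀ true) ps (replicate-true-noTrailingFalse b₀) pos))
    where
    b₀ = proj₁ (decomp δs)
    ps = proj₂ (decomp δs)
    δs≡′ : δs ≡ replicate b₀ true ++ blocks ps
    δs≡′ = trans δs≡ (trans (sym (++-assoc (replicate b₀ true) _ [])) (++-identityʳ _))
  ... | record { rest-zeros = inj₂ (a , a≥1 , refl) ; δs≡ = δs≡ ; blocks-positive = pos } = record
    { before    = before
    ; after     = proj₁ zeros
    ; δs≡       = trans δs≡ split
    ; c≡        = c-length d k k≤l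
    ; before-ok = ++-blocks-noTrailingFalse (replicate b₀ true) (take k ps) (replicate-true-noTrailingFalse b₀)
                                            (Allₚ.take⁺ k pos)
    }
    where
    d  = decomp δs
    b₀ = proj₁ d
    ps = proj₂ d
    before = replicate b₀ true ++ blocks (take k ps)
    zeros = blocks-then-zeros (drop k ps) a a≥1 (Allₚ.drop⁺ k pos)
    split : replicate b₀ true ++ blocks ps ++ replicate a false ++ [] ≡ before ++ false ∷ proj₁ zeros
    split = begin
      replicate b₀ true ++ blocks ps ++ replicate a false ++ []
        ≡⟨ cong (λ xs → replicate b₀ true ++ xs ++ replicate a false ++ []) (blocks-take-drop k ps) ⟩
      replicate b₀ true ++ (blocks (take k ps) ++ blocks (drop k ps)) ++ replicate a false ++ []
        ≡⟨ cong (replicate b₀ true ++_) (++-assoc (blocks (take k ps)) _ _) ⟩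
      replicate b₀ true ++ blocks (take k ps) ++ blocks (drop k ps) ++ replicate a false ++ []
        ≡⟨ ++-assoc (replicate b₀ true) _ _ ⟨
      before ++ blocks (drop k ps) ++ replicate a false ++ []
        ≡⟨ cong (before ++_) (proj₂ zeros) ⟩
      before ++ false ∷ proj₁ zeros
        ∎
      where open Relation.Binary.PropositionalEquality.≡-Reasoning

  applyUpTo-≡-++-∷ : ∀ {A : Set} (h : ℕ → A) N before x after →
                     applyUpTo h N ≡ before ++ x ∷ after → h (length before) ≡ x
  applyUpTo-≡-++-∷ h zero    []           x after ()
  applyUpTo-≡-++-∷ h zero    (_ ∷ _)      x after ()
  applyUpTo-≡-++-∷ h (suc N) []           x after refl = refl
  applyUpTo-≡-++-∷ h (suc N) (y ∷ before) x after e =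
    applyUpTo-≡-++-∷ (h ∘ suc) N before x after (cong (λ { [] → [] ; (_ ∷ t) → t }) e)

  left-of-insertion : ∀ (h : ℕ → Bool) N {c} before after → c ≡ suc (length before) →
                      applyUpTo h N ≡ before ++ false ∷ after → NoTrailingFalse before →
                      c ≡ 1 ⊎ Σ ℕ λ c′ → c ≡ suc (suc c′) × h c′ ≡ true
  left-of-insertion h N .[]                 after c≡ δs≡ (inj₁ refl)        = inj₁ c≡
  left-of-insertion h N .(zs ++ true ∷ []) after c≡ δs≡ (inj₂ (zs , refl)) = inj₂ (length zs
    , trans c≡ (cong suc (trans (length-++ zs) (ℕₚ.+-comm (length zs) 1)))
    , applyUpTo-≡-++-∷ h N zs true (false ∷ after) (trans δs≡ (++-assoc zs (true ∷ []) (false ∷ after))))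

  record InsertionColumn (r : ℕ) (T : Tab) (c : ℕ) : Set where
    field
      uncoloured    : isColored r (top T c) ≡ false
      left-coloured : c ≡ 1 ⊎ Σ ℕ λ c′ → c ≡ suc (suc c′) × isColored r (top T (suc c′)) ≡ true

  insertionColumn : ∀ r n T → isColored r (top T (suc n)) ≡ false →
                    ∀ k → k ≤ Blocks.l (decomp (δseq r n T)) → InsertionColumn r T (Blocks.c (decomp (δseq r n T)) k)
  insertionColumn r n T last-uncoloured k k≤l = record
    { uncoloured    = subst (λ c → isColored r (top T c) ≡ false) (sym c≡)
                            (applyUpTo-≡-++-∷ h (suc n) before false after δs≡)
    ; left-coloured = left-of-insertion h (suc n) before after c≡ δs≡ before-ok
    }
    where
    h : ℕ → Bool
    h i = isColored r (top T (suc i))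
    δs-ends-false : δseq r n T ≡ applyUpTo h n ++ false ∷ []
    δs-ends-false = trans (sym (applyUpTo-∷ʳ h n)) (cong (λ x → applyUpTo h n ++ x ∷ []) last-uncoloured)
    open InsertionPoint (insertionPoint (δseq r n T) (applyUpTo h n) δs-ends-false k k≤l)

*F-nonzero : ∀ x y → NonZeroDen x → NonZeroDen y → NonZeroDen (x *F y)
*F-nonzero x y = *P-nonzero (den x) (den y)

prodF-nonzero : ∀ {xs} → All NonZeroDen xs → NonZeroDen (prodF xs)
prodF-nonzero             []         = 1≉0
prodF-nonzero {x ∷ xs} (x≉0 ∷ ps) = *F-nonzero x (prodF xs) x≉0 (prodF-nonzero ps)

range-bounds : ∀ lo hi i → i < suc hi ∸ lo → lo ℕ.+ i ≤ hi
range-bounds zero           hi       i (s≤s i≤hi) = i≤hi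
range-bounds (suc lo)       (suc hi) i i<         = s≤s (range-bounds lo hi i i<)
range-bounds (suc zero)     zero     i ()
range-bounds (suc (suc lo)) zero     i ()

prodR-nonzero : ∀ f lo hi → (∀ i → lo ≤ i → i ≤ hi → NonZeroDen (f i)) → NonZeroDen (prodR f lo hi)
prodR-nonzero f lo hi f≉0 = prodF-nonzero (Allₚ.map⁺ (Allₚ.applyUpTo⁺₁ (lo ℕ.+_) (suc hi ∸ lo)
  λ {i} i< → f≉0 (lo ℕ.+ i) (ℕₚ.m≤m+n lo i) (range-bounds lo hi i i<)))

qint-nonzero : ∀ s → 1 ≤ s → NonZeroPoly (qint s)
qint-nonzero (suc s) _ e with e zero
... | ()

sumR-≥-first : ∀ (f : ℕ → ℕ) lo hi → lo ≤ hi → f lo ≤ sumR f lo hi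
sumR-≥-first f lo hi lo≤hi rewrite ℕₚ.+-∸-assoc 1 lo≤hi | ℕₚ.+-identityʳ lo = ℕₚ.m≤m+n (f lo) _

a-positive : ∀ d → All PositiveBlock (proj₂ d) → ∀ i → 1 ≤ i → i ≤ Blocks.l d → 1 ≤ Blocks.a d i
a-positive d pos (suc i) _ i≤l = proj₁ (nth-positive (proj₂ d) i pos i≤l)
  where
  nth-positive : ∀ ps j → All PositiveBlock ps → j < length ps → PositiveBlock (nth ps j)
  nth-positive (_ ∷ _)  zero    (p ∷ _)  _         = p
  nth-positive (_ ∷ ps) (suc j) (_ ∷ qs) (s≤s j<l) = nth-positive ps j qs j<l

-- Every denominator is [s]_q with s ≥ a_i ≥ 1.
φ-nonzero : ∀ d → All PositiveBlock (proj₂ d) → ∀ k → k ≤ Blocks.l d → NonZeroDen (Blocks.φ d k)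
φ-nonzero d pos k k≤l =
  *F-nonzero (polyF (qpow (sumR a 1 k))) (φ-before k *F φ-after k) 1≉0
             (*F-nonzero (φ-before k) (φ-after k) before-nonzero after-nonzero)
  where
  open Blocks d
  before-nonzero : NonZeroDen (φ-before k)
  before-nonzero = prodR-nonzero _ 1 k λ i 1≤i i≤k → qint-nonzero _
    (ℕₚ.≤-trans (a-positive d pos i 1≤i (ℕₚ.≤-trans i≤k k≤l))
                (ℕₚ.≤-trans (sumR-≥-first a i k i≤k) (ℕₚ.m≤m+n _ _)))
  after-nonzero : NonZeroDen (φ-after k)
  after-nonzero = prodR-nonzero _ (suc k) l λ i k<i i≤l → qint-nonzero _
    (ℕₚ.≤-trans (a-positive d pos (suc k) (s≤s z≤n) (ℕₚ.≤-trans k<i i≤l))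
                (ℕₚ.≤-trans (sumR-≥-first a (suc k) i k<i) (ℕₚ.m≤m+n _ _)))

ΩT-WF : ∀ r n T → WF (ΩT r n T)
ΩT-WF r n T = subst WF (sym (ΩT-blocks r n T))
  (Allₚ.map⁺ (Allₚ.applyUpTo⁺₁ id (suc l) λ k<1+l → φ-nonzero d positive _ (ℕₚ.≤-pred k<1+l)))
  where
  δs = δseq r n T
  d  = decomp δs
  open Blocks d using (l)
  positive = BlockDecomposition.blocks-positive (decomp-spec δs)

-- Adding a box labelled n+1 to a standard Young tableau

NonEmpty : List ℕ → Set
NonEmpty col = col ≢ []

labels-≤ : ∀ n T → concat T ↭ applyUpTo suc n → All (All (_< suc n)) T
labels-≤ n T perm = Allₚ.concat⁻ (↭ₚ.All-resp-↭ (↭-sym perm) (Allₚ.applyUpTo⁺₁ suc n s≤s))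

length≤length-concat : ∀ T → All NonEmpty T → length T ≤ length (concat T)
length≤length-concat []              []         = z≤n
length≤length-concat ([] ∷ T)        (ne ∷ _)   = contradiction refl ne
length≤length-concat ((x ∷ c) ∷ T) (_ ∷ nes) =
  s≤s (subst (length T ≤_) (sym (length-++ c)) (ℕₚ.≤-trans (length≤length-concat T nes) (ℕₚ.m≤n+m _ (length c))))

SYT-width : ∀ n T → IsSYT n T → length T ≤ n
SYT-width n T (nes , _ , _ , perm) =
  subst (length T ≤_) (trans (↭ₚ.↭-length perm) (length-applyUpTo suc n)) (length≤length-concat T nes)

column-beyond : ∀ T i → length T < i → column T i ≡ []
column-beyond T       zero          ()
column-beyond []      (suc i)       _             = refl
column-beyond (c ∷ T) (suc zero)    (s≤s ())
column-beyond (c ∷ T) (suc (suc i)) (s≤s T<1+i) = column-beyond T (suc i) T<1+i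

column-nonempty : ∀ T i → NonEmpty (column T (suc i)) → suc i ≤ length T
column-nonempty []      i       ne = contradiction refl ne
column-nonempty (c ∷ T) zero    ne = s≤s z≤n
column-nonempty (c ∷ T) (suc i) ne = s≤s (column-nonempty T i ne)

isColored⇒nonempty : ∀ r col → isColored r (last col) ≡ true → NonEmpty col
isColored⇒nonempty r .[] () refl

RowLt-++ˡ : ∀ c d e → RowLt c d → RowLt (c ++ e) d
RowLt-++ˡ c       []      e _             = tt
RowLt-++ˡ []      (z ∷ d) e ()
RowLt-++ˡ (y ∷ c) (z ∷ d) e (y<z , c<d) = y<z , RowLt-++ˡ c d e c<d

RowLt-∷ʳ : ∀ c d x → RowLt c d → length d < length c → All (_< x) c → RowLt c (d ++ x ∷ [])
RowLt-∷ʳ (y ∷ c) []      x _             _         (y<x ∷ _) = y<x , tt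
RowLt-∷ʳ (y ∷ c) (z ∷ d) x (y<z , c<d) (s≤s d<c) (_ ∷ c<x) = y<z , RowLt-∷ʳ c d x c<d d<c c<x

-- Were d as long as c, its top would exceed the coloured top of c.
coloured-uncoloured⇒shorter : ∀ r c d → RowLt c d → isColored r (last c) ≡ true →
                              isColored r (last d) ≡ false → length d < length c
coloured-uncoloured⇒shorter r (y ∷ c)         []            _           _     _     = s≤s z≤n
coloured-uncoloured⇒shorter r (y ∷ [])        (z ∷ [])      (y<z , _)   c-col d-unc
  with r ℕ.<? y
... | yes r<y = contradiction (trans (sym (isColored-> (ℕₚ.<-trans r<y y<z))) d-unc) λ ()
... | no  _   = contradiction c-col λ ()
coloured-uncoloured⇒shorter r (y ∷ y′ ∷ c)    (z ∷ [])      _           _     _     = s≤s (s≤s z≤n)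
coloured-uncoloured⇒shorter r (y ∷ [])        (z ∷ z′ ∷ d)  (_ , ())    _     _
coloured-uncoloured⇒shorter r (y ∷ y′ ∷ c)    (z ∷ z′ ∷ d)  (_ , c<d)   c-col d-unc =
  s≤s (coloured-uncoloured⇒shorter r (y′ ∷ c) (z′ ∷ d) c<d c-col d-unc)

RowLt-column : ∀ T → Linked RowLt T → ∀ i → RowLt (column T (suc i)) (column T (suc (suc i)))
RowLt-column []           _          i       = tt
RowLt-column (c ∷ [])     _          zero    = tt
RowLt-column (c ∷ [])     _          (suc i) = tt
RowLt-column (c ∷ c′ ∷ T) (c<c′ ∷ _) zero    = c<c′
RowLt-column (c ∷ c′ ∷ T) (_ ∷ lk)   (suc i) = RowLt-column (c′ ∷ T) lk i

addTop-nonEmpty : ∀ j x T → All NonEmpty T → j ≤ length T → All NonEmpty (addTop (suc j) x T)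
addTop-nonEmpty zero    x []      _          _         = (λ ()) ∷ []
addTop-nonEmpty zero    x (c ∷ T) (_ ∷ nes)  _         = ∷ʳ-nonEmpty c ∷ nes
  where
  ∷ʳ-nonEmpty : ∀ c → NonEmpty (c ++ x ∷ [])
  ∷ʳ-nonEmpty []      ()
  ∷ʳ-nonEmpty (_ ∷ _) ()
addTop-nonEmpty (suc j) x (c ∷ T) (ne ∷ nes) (s≤s j≤l) = ne ∷ addTop-nonEmpty j x T nes j≤l

Linked-∷ʳ : ∀ c x → Linked _<_ c → All (_< x) c → Linked _<_ (c ++ x ∷ [])
Linked-∷ʳ []          x _           _         = [-]
Linked-∷ʳ (y ∷ [])    x _           (y<x ∷ _) = y<x ∷ [-]
Linked-∷ʳ (y ∷ z ∷ c) x (y<z ∷ lk) (_ ∷ c<x) = y<z ∷ Linked-∷ʳ (z ∷ c) x lk c<x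

addTop-increasing : ∀ j x T → All (Linked _<_) T → All (All (_< x)) T → All (Linked _<_) (addTop (suc j) x T)
addTop-increasing zero    x []      _          _          = [-] ∷ []
addTop-increasing zero    x (c ∷ T) (lk ∷ lks) (c<x ∷ _)  = Linked-∷ʳ c x lk c<x ∷ lks
addTop-increasing (suc j) x []      _          _          = [] ∷ addTop-increasing j x [] [] []
addTop-increasing (suc j) x (c ∷ T) (lk ∷ lks) (_ ∷ T<x)  = lk ∷ addTop-increasing j x T lks T<x

addTop-labels : ∀ j x T → j ≤ length T → concat (addTop (suc j) x T) ↭ concat T ++ x ∷ []
addTop-labels zero    x []      _ = ↭-refl
addTop-labels zero    x (c ∷ T) _ =
  ↭-trans (↭-reflexive (++-assoc c (x ∷ []) (concat T)))
  (↭-trans (↭ₚ.++⁺ˡ c (↭ₚ.++-comm (x ∷ []) (concat T))) (↭-reflexive (sym (++-assoc c (concat T) (x ∷ [])))))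
addTop-labels (suc j) x (c ∷ T) (s≤s j≤l) =
  ↭-trans (↭ₚ.++⁺ˡ c (addTop-labels j x T j≤l)) (↭-reflexive (sym (++-assoc c (concat T) (x ∷ []))))

addTop-rows : ∀ j x T → Linked RowLt T → All (All (_< x)) T → j ≤ length T →
              (j ≡ 0 ⊎ length (column T (suc j)) < length (column T j)) →
              Linked RowLt (addTop (suc j) x T)
addTop-rows zero x []           _          _          _ _ = [-]
addTop-rows zero x (c ∷ [])     _          _          _ _ = [-]
addTop-rows zero x (c ∷ c′ ∷ T) (c<c′ ∷ lk) _         _ _ = RowLt-++ˡ c c′ (x ∷ []) c<c′ ∷ lk
addTop-rows (suc zero) x (c ∷ []) _ (c<x ∷ _) _ (inj₂ shorter) = RowLt-∷ʳ c [] x tt shorter c<x ∷ [-]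
addTop-rows (suc zero) x (c ∷ c′ ∷ T) (c<c′ ∷ lk) (c<x ∷ T<x) _ (inj₂ shorter) =
  RowLt-∷ʳ c c′ x c<c′ shorter c<x ∷ addTop-rows zero x (c′ ∷ T) lk T<x z≤n (inj₁ refl)
addTop-rows (suc (suc j)) x (c ∷ c′ ∷ T) (c<c′ ∷ lk) (_ ∷ T<x) (s≤s j≤l) (inj₂ shorter) =
  c<c′ ∷ addTop-rows (suc j) x (c′ ∷ T) lk T<x j≤l (inj₂ shorter)
addTop-rows (suc (suc j)) x (c ∷ []) _ _ (s≤s ()) _

column-addTop : ∀ j x T i → i ≢ j → column (addTop j x T) i ≡ column T i
column-addTop zero          x T       i             _   = refl
column-addTop (suc j)       x T       zero          _   = refl
column-addTop (suc zero)    x []      (suc zero)    i≢j = contradiction refl i≢j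
column-addTop (suc zero)    x (c ∷ T) (suc zero)    i≢j = contradiction refl i≢j
column-addTop (suc zero)    x []      (suc (suc i)) _   = refl
column-addTop (suc zero)    x (c ∷ T) (suc (suc i)) _   = refl
column-addTop (suc (suc j)) x []      (suc zero)    _   = refl
column-addTop (suc (suc j)) x (c ∷ T) (suc zero)    _   = refl
column-addTop (suc (suc j)) x []      (suc (suc i)) i≢j = column-addTop (suc j) x [] (suc i) (i≢j ∘ cong suc)
column-addTop (suc (suc j)) x (c ∷ T) (suc (suc i)) i≢j = column-addTop (suc j) x T (suc i) (i≢j ∘ cong suc)

addTop-SYT : ∀ n T j → IsSYT n T → j ≤ length T →
             (j ≡ 0 ⊎ length (column T (suc j)) < length (column T j)) →
             IsSYT (suc n) (addTop (suc j) (suc n) T)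
addTop-SYT n T j (nes , incr , rows , perm) j≤l shorter =
    addTop-nonEmpty j (suc n) T nes j≤l
  , addTop-increasing j (suc n) T incr labels<
  , addTop-rows j (suc n) T rows labels< j≤l shorter
  , ↭-trans (addTop-labels j (suc n) T j≤l)
            (↭-trans (↭ₚ.++⁺ʳ (suc n ∷ []) perm) (↭-reflexive (applyUpTo-∷ʳ suc n)))
  where labels< = labels-≤ n T perm

-- Ω_r sends generators of M_{m,n} to generators of M_{m,n+1}

ΩT-Gen : ∀ {r m n col L T} → r < m → Gen m n col L T → All (λ e → Gen m (suc n) col L (proj₂ e)) (ΩT r n T)
ΩT-Gen {r} {m} {n} {col} {L} {T} r<m (syt , 1≤col , 1≤L , top-col , top-col+L) =
  subst (All _) (sym (ΩT-blocks r n T))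
    (Allₚ.map⁺ (Allₚ.applyUpTo⁺₁ id (suc l) λ k<1+l → new-Gen _ (ℕₚ.≤-pred k<1+l)))
  where
  open Blocks (decomp (δseq r n T)) using (c; l)
  rows = proj₁ (proj₂ (proj₂ syt))

  last-uncoloured : isColored r (top T (suc n)) ≡ false
  last-uncoloured rewrite column-beyond T (suc n) (s≤s (SYT-width n T syt)) = refl

  new-SYT : ∀ k → k ≤ l → IsSYT (suc n) (addTop (c k) (suc n) T)
  new-SYT k k≤l with insertionColumn r n T last-uncoloured k k≤l
  ... | record { left-coloured = inj₁ c≡1 } rewrite c≡1 = addTop-SYT n T 0 syt z≤n (inj₁ refl)
  ... | record { uncoloured = unc ; left-coloured = inj₂ (c′ , c≡ , coloured) } rewrite c≡ =
    addTop-SYT n T (suc c′) syt (column-nonempty T c′ (isColored⇒nonempty r _ coloured))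
      (inj₂ (coloured-uncoloured⇒shorter r _ _ (RowLt-column T rows c′) coloured unc))

  keeps-coloured-top : ∀ k → k ≤ l → ∀ i x → top T i ≡ just x → r < x →
                       top (addTop (c k) (suc n) T) i ≡ just x
  keeps-coloured-top k k≤l i x top-i r<x = trans (cong last (column-addTop (c k) (suc n) T i i≢c)) top-i
    where
    i≢c : i ≢ c k
    i≢c refl = contradiction (trans (sym (trans (cong (isColored r) top-i) (isColored-> r<x)))
                                    (InsertionColumn.uncoloured (insertionColumn r n T last-uncoloured k k≤l)))
                             λ ()

  new-Gen : ∀ k → k ≤ l → Gen m (suc n) col L (addTop (c k) (suc n) T)
  new-Gen k k≤l = new-SYT k k≤l , 1≤col , 1≤L
                , keeps-coloured-top k k≤l col m top-col r<m
                , keeps-coloured-top k k≤l (col ℕ.+ L) (suc m) top-col+L (ℕₚ.m<n⇒m<1+n r<m)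

Tab-≟ : DecidableEquality Tab
Tab-≟ = ≡-dec (≡-dec ℕ._≟_)

module Q = FormalCombination ℚ⟨q⟩-commutativeSemiring Tab-≟
open Q using (Combination; _≈ᶜ_; mk≈ᶜ; coef-≈)

forget : Combination → V
forget = map (λ e → value (proj₁ e) , proj₂ e)

attach : (v : V) → WF v → Combination
attach []            []          = []
attach ((x , S) ∷ v) (x≉0 ∷ v≉0) = ((x , x≉0) , S) ∷ attach v v≉0

forget-attach : ∀ v (v≉0 : WF v) → forget (attach v v≉0) ≡ v
forget-attach []            []          = refl
forget-attach ((x , S) ∷ v) (x≉0 ∷ v≉0) = cong (_ ∷_) (forget-attach v v≉0)

attach-All : ∀ {P : Tab → Set} v (v≉0 : WF v) → All (P ∘ proj₂) v → All (P ∘ proj₂) (attach v v≉0)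
attach-All []            []          []         = []
attach-All ((x , S) ∷ v) (x≉0 ∷ v≉0) (pS ∷ pv) = pS ∷ attach-All v v≉0 pv

coefV-forget : ∀ v T → coefV (forget v) T ≡ value (Q.coef v T)
coefV-forget []             T = refl
coefV-forget ((a , S) ∷ v) T with Tab-≟ S T
... | yes _ = cong (value a +F_) (coefV-forget v T)
... | no  _ = coefV-forget v T

≈ᶜ⇒≈V : ∀ {v w} → v ≈ᶜ w → forget v ≈V forget w
≈ᶜ⇒≈V {v} {w} v≈w T rewrite coefV-forget v T | coefV-forget w T = coeff-≡ (cross-≋ (coef-≈ v≈w T))

≈V⇒≈ᶜ : ∀ {v w} → forget v ≈V forget w → v ≈ᶜ w
≈V⇒≈ᶜ {v} {w} v≈w = mk≈ᶜ λ T → mk≈Q (mk≋ (subst₂ _≈F_ (coefV-forget v T) (coefV-forget w T) (v≈w T)))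

forget-≡⇒≈ᶜ : ∀ {v w} → forget v ≡ forget w → v ≈ᶜ w
forget-≡⇒≈ᶜ {v} {w} v≡w = ≈V⇒≈ᶜ (subst (λ u → forget v ≈V u) v≡w λ T → λ i → refl)

forget-scale : ∀ a v → forget (Q.scaleᶜ a v) ≡ scale (value a) (forget v)
forget-scale a []      = refl
forget-scale a (_ ∷ v) = cong (_ ∷_) (forget-scale a v)

forget-rename : ∀ h v → forget (Q.rename h v) ≡ map (λ e → proj₁ e , h (proj₂ e)) (forget v)
forget-rename h []      = refl
forget-rename h (_ ∷ v) = cong (_ ∷_) (forget-rename h v)

forget-concatMap-scale : ∀ {A : Set} (coefficient : A → ℚ⟨q⟩) (f : A → Combination) (g : A → V) →
                         (∀ x → forget (f x) ≡ g x) → ∀ xs →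
                         forget (concatMap (λ x → Q.scaleᶜ (coefficient x) (f x)) xs)
                           ≡ concatMap (λ x → scale (value (coefficient x)) (g x)) xs
forget-concatMap-scale coefficient f g f≡g []       = refl
forget-concatMap-scale coefficient f g f≡g (x ∷ xs) = begin
  forget (Q.scaleᶜ (coefficient x) (f x) ++ _)
    ≡⟨ map-++ _ (Q.scaleᶜ (coefficient x) (f x)) _ ⟩
  forget (Q.scaleᶜ (coefficient x) (f x)) ++ forget (concatMap _ xs)
    ≡⟨ cong₂ _++_ (trans (forget-scale (coefficient x) (f x))
                         (cong (scale (value (coefficient x))) (f≡g x)))
                  (forget-concatMap-scale coefficient f g f≡g xs) ⟩
  scale (value (coefficient x)) (g x) ++ concatMap _ xs
    ∎
  where open Relation.Binary.PropositionalEquality.≡-Reasoning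

ΩQ : ℕ → ℕ → Tab → Combination
ΩQ r n T = attach (ΩT r n T) (ΩT-WF r n T)

forget-bind-ΩQ : ∀ r n v → forget (Q.bind (ΩQ r n) v) ≡ Ω r n (forget v)
forget-bind-ΩQ r n v =
  trans (forget-concatMap-scale proj₁ (ΩQ r n ∘ proj₂) (ΩT r n ∘ proj₂) (λ e → forget-attach _ _) v)
        (sym (concatMap-map _ _ v))

ΩQ-τ : ∀ {r m n} → r < m → m < n → ∀ T → ΩQ r n (τ m T) Q.≈ᶜ Q.rename (τ m) (ΩQ r n T)
ΩQ-τ {r} {m} {n} r<m m<n T = forget-≡⇒≈ᶜ (begin
  forget (ΩQ r n (τ m T))                                       ≡⟨ forget-attach _ _ ⟩
  ΩT r n (τ m T)                                                ≡⟨ ΩT-τ r<m m<n T ⟩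
  map (λ e → proj₁ e , τ m (proj₂ e)) (ΩT r n T)                ≡⟨ cong (map _) (forget-attach _ _) ⟨
  map (λ e → proj₁ e , τ m (proj₂ e)) (forget (ΩQ r n T))       ≡⟨ forget-rename (τ m) (ΩQ r n T) ⟨
  forget (Q.rename (τ m) (ΩQ r n T))                            ∎)
  where open Relation.Binary.PropositionalEquality.≡-Reasoning

ρ : ℕ → ℚ⟨q⟩
ρ L = (qvar *P qint (L ∸ 1)) ÷P qint (suc L) , qint-nonzero (suc L) (s≤s z≤n)

-- [0]_q = 0, so R_m(T) = T + ρ_L τ_m(T) also for L = 1.
ρ1≈0 : ρ 1 ≈Q 0Q
ρ1≈0 = mk≈Q (mk≋ λ { zero → refl ; (suc zero) → refl ; (suc (suc i)) → refl })

R-WF : ∀ m L T → WF (R m L T)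
R-WF m zero          T = 1≉0 ∷ den≉0 (ρ 0) ∷ []
R-WF m (suc zero)    T = 1≉0 ∷ []
R-WF m (suc (suc L)) T = 1≉0 ∷ den≉0 (ρ (suc (suc L))) ∷ []

RQ : ℕ → ℕ → Tab → Combination
RQ m L T = attach (R m L T) (R-WF m L T)

RQ≈pair : ∀ m L T → RQ m L T Q.≈ᶜ Q.pair (ρ L) (τ m) T
RQ≈pair m zero          T = Q.≈ᶜ-refl
RQ≈pair m (suc zero)    T = Q.∷-cong T ≈Q-refl (Q.≈ᶜ-sym (Q.∷-≈0 (τ m T) [] ρ1≈0))
RQ≈pair m (suc (suc L)) T = Q.≈ᶜ-refl

GenQ : Set
GenQ = ℚ⟨q⟩ × ℕ × ℕ × Tab

forgetGen : GenQ → GenData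
forgetGen (a , g) = value a , g

lincombQ : ℕ → List GenQ → Combination
lincombQ m = concatMap λ g → Q.scaleᶜ (proj₁ g) (RQ m (proj₁ (proj₂ (proj₂ g))) (proj₂ (proj₂ (proj₂ g))))

forget-lincombQ : ∀ m gs → forget (lincombQ m gs) ≡ lincomb m (map forgetGen gs)
forget-lincombQ m gs =
  trans (forget-concatMap-scale proj₁ _ _ (λ g → forget-attach _ _) gs) (sym (concatMap-map _ forgetGen gs))

newGens : ℕ → ℕ → GenQ → List GenQ
newGens r n (a , col , L , T) = map (λ e → a *Q proj₁ e , col , L , proj₂ e) (ΩQ r n T)

lincombQ-newGens : ∀ r m n a col L T →
                   lincombQ m (newGens r n (a , col , L , T)) ≡ Q.bind (RQ m L) (Q.scaleᶜ a (ΩQ r n T))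
lincombQ-newGens r m n a col L T = go (ΩQ r n T)
  where
  go : ∀ X → lincombQ m (map (λ e → a *Q proj₁ e , col , L , proj₂ e) X) ≡ Q.bind (RQ m L) (Q.scaleᶜ a X)
  go []      = refl
  go (_ ∷ X) = cong (_ ++_) (go X)

Ω-generator : ∀ {r m n} → r < m → m < n → ∀ a col L T →
              Q.bind (ΩQ r n) (Q.scaleᶜ a (RQ m L T)) Q.≈ᶜ lincombQ m (newGens r n (a , col , L , T))
Ω-generator {r} {m} {n} r<m m<n a col L T = begin
  Q.bind Ω′ (Q.scaleᶜ a (RQ m L T))
    ≈⟨ Q.bind-scale Ω′ a (RQ m L T) ⟩
  Q.scaleᶜ a (Q.bind Ω′ (RQ m L T))
    ≈⟨ Q.scale-cong a (Q.bind-congʳ Ω′ (RQ≈pair m L T)) ⟩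
  Q.scaleᶜ a (Q.bind Ω′ (Q.pair (ρ L) (τ m) T))
    ≈⟨ Q.scale-cong a (Q.bind-pair-comm Ω′ (ρ L) (τ m) (ΩQ-τ r<m m<n) T) ⟩
  Q.scaleᶜ a (Q.bind (Q.pair (ρ L) (τ m)) (Ω′ T))
    ≈⟨ Q.scale-cong a (Q.bind-congˡ (λ S → Q.≈ᶜ-sym (RQ≈pair m L S)) (Ω′ T)) ⟩
  Q.scaleᶜ a (Q.bind (RQ m L) (Ω′ T))
    ≈⟨ Q.bind-scale (RQ m L) a (Ω′ T) ⟨
  Q.bind (RQ m L) (Q.scaleᶜ a (Ω′ T))
    ≡⟨ lincombQ-newGens r m n a col L T ⟨
  lincombQ m (newGens r n (a , col , L , T))
    ∎
  where
  Ω′ = ΩQ r n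
  open import Relation.Binary.Reasoning.Setoid Q.≈ᶜ-setoid

Ω-lincombQ : ∀ {r m n} → r < m → m < n → ∀ gs →
             Q.bind (ΩQ r n) (lincombQ m gs) Q.≈ᶜ lincombQ m (concatMap (newGens r n) gs)
Ω-lincombQ r<m m<n [] = Q.≈ᶜ-refl
Ω-lincombQ {r} {m} {n} r<m m<n (g@(a , col , L , T) ∷ gs) = begin
  Q.bind (ΩQ r n) (Q.scaleᶜ a (RQ m L T) ++ lincombQ m gs)
    ≡⟨ concatMap-++ _ (Q.scaleᶜ a (RQ m L T)) (lincombQ m gs) ⟩
  Q.bind (ΩQ r n) (Q.scaleᶜ a (RQ m L T)) ++ Q.bind (ΩQ r n) (lincombQ m gs)
    ≈⟨ Q.++-cong (Ω-generator r<m m<n a col L T) (Ω-lincombQ r<m m<n gs) ⟩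
  lincombQ m (newGens r n g) ++ lincombQ m (concatMap (newGens r n) gs)
    ≡⟨ concatMap-++ _ (newGens r n g) (concatMap (newGens r n) gs) ⟨
  lincombQ m (concatMap (newGens r n) (g ∷ gs))
    ∎
  where open import Relation.Binary.Reasoning.Setoid Q.≈ᶜ-setoid

GenAt : ℕ → ℕ → ℕ × ℕ × Tab → Set
GenAt m N (col , L , T) = Gen m N col L T

attachGens : (gs : List GenData) → All (NonZeroDen ∘ proj₁) gs → List GenQ
attachGens []             []          = []
attachGens ((x , g) ∷ gs) (x≉0 ∷ gs≉0) = ((x , x≉0) , g) ∷ attachGens gs gs≉0

forget-attachGens : ∀ gs gs≉0 → map forgetGen (attachGens gs gs≉0) ≡ gs
forget-attachGens []             []           = refl
forget-attachGens ((x , g) ∷ gs) (x≉0 ∷ gs≉0) = cong (_ ∷_) (forget-attachGens gs gs≉0)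

attachGens-All : ∀ {P : ℕ × ℕ × Tab → Set} gs gs≉0 → All (P ∘ proj₂) gs → All (P ∘ proj₂) (attachGens gs gs≉0)
attachGens-All []             []           []         = []
attachGens-All ((x , g) ∷ gs) (x≉0 ∷ gs≉0) (pg ∷ pgs) = pg ∷ attachGens-All gs gs≉0 pgs

forgetGens-All : ∀ {m N} gs → All (GenAt m N ∘ proj₂) gs →
                 All (λ g → NonZeroDen (proj₁ g) × GenAt m N (proj₂ g)) (map forgetGen gs)
forgetGens-All []             []           = []
forgetGens-All ((a , _) ∷ gs) (gen ∷ gens) = (den≉0 a , gen) ∷ forgetGens-All gs gens

newGens-GenAt : ∀ {r m n} → r < m → ∀ gs → All (GenAt m n ∘ proj₂) gs →
                All (GenAt m (suc n) ∘ proj₂) (concatMap (newGens r n) gs)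
newGens-GenAt {r} {m} {n} r<m gs gens =
  Allₚ.concat⁺ (Allₚ.map⁺ {f = newGens r n} (All.map (λ {g} → new {g}) gens))
  where
  new : ∀ {g} → GenAt m n (proj₂ g) → All (GenAt m (suc n) ∘ proj₂) (newGens r n g)
  new {a , col , L , T} gen = Allₚ.map⁺ (attach-All (ΩT r n T) (ΩT-WF r n T) (ΩT-Gen r<m gen))

lemma3p4 : (r m n : ℕ) → 1 ≤ r → r < m → m < n →
           (v : V) → WF v → InM m n v → InM m (suc n) (Ω r n v)
lemma3p4 r m n _ r<m m<n v v≉0 (gs , gs-gen , v≈) = map forgetGen gs′ , gs′-gen , Ωv≈
  where
  gsQ gs′ : List GenQ
  gsQ = attachGens gs (All.map proj₁ gs-gen)
  gs′ = concatMap (newGens r n) gsQ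

  gs′-gen : All (λ g → NonZeroDen (proj₁ g) × GenAt m (suc n) (proj₂ g)) (map forgetGen gs′)
  gs′-gen = forgetGens-All gs′ (newGens-GenAt r<m gsQ (attachGens-All gs _ (All.map proj₂ gs-gen)))

  v≈lincombQ : attach v v≉0 Q.≈ᶜ lincombQ m gsQ
  v≈lincombQ = ≈V⇒≈ᶜ (subst₂ _≈V_ (sym (forget-attach v v≉0))
    (trans (cong (lincomb m) (sym (forget-attachGens gs _))) (sym (forget-lincombQ m gsQ))) v≈)

  Ωv≈lincombQ : Q.bind (ΩQ r n) (attach v v≉0) Q.≈ᶜ lincombQ m gs′
  Ωv≈lincombQ = Q.≈ᶜ-trans (Q.bind-congʳ (ΩQ r n) v≈lincombQ) (Ω-lincombQ r<m m<n gsQ)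

  Ωv≈ : Ω r n v ≈V lincomb m (map forgetGen gs′)
  Ωv≈ = subst₂ _≈V_ (trans (forget-bind-ΩQ r n (attach v v≉0)) (cong (Ω r n) (forget-attach v v≉0)))
                    (forget-lincombQ m gs′) (≈ᶜ⇒≈V Ωv≈lincombQ)
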